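{- Let $k,\ell\ge0$ be integers and let $P=P(x,y)=\sum_{n\ge0}\sum_{\pi\in\mathcal{S}_n(2\text{ - }1\text{ - }3)}y^{e(\pi)}x^n$, where $e(\pi)$ is the number of occurrences of the segmented pattern $a_1a_2\cdots a_k\,a\,a_{k+1}\cdots a_{k+\ell}$ in $\pi$. Let $P_m=\sum_{n=0}^{m-1}\frac{1}{n+1}\binom{2n}{n}x^n$ for $m\ge0$. Then $$P=\frac{1-x(1-y)(P_k+P_\ell)-\sqrt{(x(1-y)(P_k+P_\ell)-1)^2-4xy(x(y-1)P_kP_\ell+1)}}{2xy}.$$
   Context: $\mathcal{S}_n$ is the set of permutations of $\{1,\dots,n\}$ written as words $\pi_1\cdots\pi_n$. $\mathcal{S}_n(2\text{ - }1\text{ - }3)$ is the set of $\pi\in\mathcal{S}_n$ for which there are no indices $i<j<l$ with $\pi_j<\pi_i<\pi_l$. An occurrence of $a_1\cdots a_k\,a\,a_{k+1}\cdots a_{k+\ell}$ (poset with only relations $a<a_i$) in $\pi$ is a factor $\pi_i\cdots\pi_{i+k+\ell}$ of $k+\ell+1$ consecutive letters whose $(k+1)$-st letter is smaller than all its other letters. Thus $P_m$ is the sum of the first $m$ terms of the Catalan generating function $\frac{1-\sqrt{1-4x}}{2x}$. -}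

module Defs where

open import Data.Nat as ℕ using (ℕ; zero; suc; _<ᵇ_; _≡ᵇ_; _∸_)
open import Data.Nat.Combinatorics using (_C_)
open import Data.Nat.DivMod using (_/_)
open import Data.Integer as ℤ using (ℤ; +_)
open import Data.Bool using (Bool; true; false; _∧_; _∨_; not; if_then_else_)
open import Data.List using (List; []; _∷_; map; concatMap; length; take; drop; filter; upTo)
open import Data.Bool.ListAction using (all; any)
open import Relation.Nullary.Decidable using (T?)

words : ℕ → ℕ → List (List ℕ)
words m zero    = [] ∷ []
words m (suc n) = concatMap (λ w → map (λ a → a ∷ w) (map suc (upTo m))) (words m n)

distinct : List ℕ → Bool
distinct []       = true
distinct (a ∷ w) = not (any (λ b → a ≡ᵇ b) w) ∧ distinct w

perms : ℕ → List (List ℕ)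
perms n = filter (λ w → T? (distinct w)) (words n n)

-- Pattern 2-1-3 : indices i<j<l with π_j < π_i < π_l

has213From : ℕ → List ℕ → Bool
has213From a []       = false
has213From a (b ∷ cs) = ((b <ᵇ a) ∧ any (λ c → a <ᵇ c) cs) ∨ has213From a cs

contains213 : List ℕ → Bool
contains213 []       = false
contains213 (a ∷ w) = has213From a w ∨ contains213 w

-- Occurrences of the segmented pattern a₁⋯a_k a a_{k+1}⋯a_{k+ℓ}:
-- factors of k+ℓ+1 consecutive letters whose (k+1)-st letter is
-- smaller than all its other letters.

isOcc : ℕ → ℕ → List ℕ → Bool
isOcc k l f with drop k f
... | []      = false
... | (m ∷ r) = (length f ≡ᵇ (k ℕ.+ l ℕ.+ 1))
                ∧ all (λ b → m <ᵇ b) (take k f)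
                ∧ all (λ b → m <ᵇ b) r

occ : ℕ → ℕ → List ℕ → ℕ
occ k l []        = 0
occ k l (a ∷ w)  =
  (if isOcc k l (take (k ℕ.+ l ℕ.+ 1) (a ∷ w)) then 1 else 0) ℕ.+ occ k l w

-- Formal power series in x, y with integer coefficients:
-- s n j = coefficient of x^n y^j

Series : Set
Series = ℕ → ℕ → ℤ

sumTo : ℕ → (ℕ → ℤ) → ℤ
sumTo zero    f = f 0
sumTo (suc n) f = sumTo n f ℤ.+ f (suc n)

_⊕_ : Series → Series → Series
(f ⊕ g) n j = f n j ℤ.+ g n j

_⊖_ : Series → Series → Series
(f ⊖ g) n j = f n j ℤ.- g n j

_⊗_ : Series → Series → Series
(f ⊗ g) n j = sumTo n (λ a → sumTo j (λ b → f a b ℤ.* g (n ∸ a) (j ∸ b)))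

infixl 6 _⊕_ _⊖_
infixl 7 _⊗_

const : ℤ → Series
const c zero zero = c
const c _    _    = + 0

X : Series
X (suc zero) zero = + 1
X _          _    = + 0

Y : Series
Y zero (suc zero) = + 1
Y _    _          = + 0

countP : ℕ → ℕ → ℕ → ℕ → ℕ
countP k l n j =
  length (filter (λ w → T? (not (contains213 w) ∧ (occ k l w ≡ᵇ j))) (perms n))

Pser : ℕ → ℕ → Series
Pser k l n j = + countP k l n j

catalan : ℕ → ℕ
catalan n = ((2 ℕ.* n) C n) / suc n

Ptrunc : ℕ → Series
Ptrunc m n zero    = if n <ᵇ m then + catalan n else + 0
Ptrunc m n (suc j) = + 0

open import Relation.Binary.PropositionalEquality using (_≡_; refl)
private
  t1 : length (perms 4) ≡ 24
  t1 = refl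
  t2 : length (filter (λ w → T? (not (contains213 w))) (perms 5)) ≡ 42
  t2 = refl
  t3 : catalan 5 ≡ 42
  t3 = refl
  t4 : occ 1 1 (2 ∷ 1 ∷ 3 ∷ 5 ∷ 4 ∷ 6 ∷ []) ≡ 2
  t4 = refl

module Submission where

-- A 213-avoider of length n + 1 factors uniquely as σ′ 1 τ′, where τ′ is a 213-avoider on
-- {2, …, t + 1} and σ′ one on {t + 2, …, n + 1}, t = |τ′|.  The occurrences of the pattern are
-- those inside σ′ and τ′ plus one centred at the letter 1, present exactly when |σ′| ≥ k and
-- |τ′| ≥ ℓ.  Hence P = 1 + xP² + x(y − 1)(P − P_k)(P − P_ℓ), because P − P_m collects the avoiders
-- of length at least m: the shorter ones (m ≤ k + ℓ + 1) have no occurrences and are counted by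
-- Catalan numbers, which match binom(2n, n)/(n + 1) through the equation (1 − 4x)u″ = 2u′ that
-- follows from u = x + u².  Then S = 1 − A − 2xyP is a square root of the discriminant D.

open import Defs
open import Data.Nat using (ℕ)
open import Data.Integer using (+_)
open import Data.Product using (∃; _×_)
open import Relation.Binary.PropositionalEquality using (_≡_)

open import Algebra.Bundles using (CommutativeRing)
open import Algebra.Structures using (IsCommutativeRing)
import Algebra.Construct.Pointwise as Pointwise
import Algebra.Properties.CommutativeSemigroup as CommutativeSemigroupProperties
open import Algebra.Solver.Ring.AlmostCommutativeRing using (fromCommutativeRing; _-Raw-AlmostCommutative⟶_)
import Algebra.Solver.Ring
open import Data.Bool using (Bool; true; false; _∧_; _∨_; not; T; if_then_else_)
open import Data.Bool.ListAction using (all; any)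
open import Data.Bool.Properties
  using (T-≡; ⇔→≡; ¬-not; not-injective; ∧-conicalˡ; ∧-conicalʳ; ∨-conicalˡ; ∨-conicalʳ;
         ∧-zeroʳ; ∧-identityʳ; ∨-zeroʳ; ∨-identityʳ; ∨-assoc)
open import Data.Empty using (⊥-elim)
open import Data.Integer as ℤ using (ℤ)
import Data.Integer.Properties as ℤₚ
open import Data.Integer.Solver using () renaming (module +-*-Solver to ℤ-Solver)
open import Data.List using (List; []; _∷_; _++_; map; concatMap; filter; length; upTo; applyUpTo; take; drop)
import Data.List.Properties as List
open import Data.List.Membership.Propositional using (_∈_; find; lose)
open import Data.List.Membership.Propositional.Properties
  using (∈-map⁺; ∈-map⁻; ∈-filter⁺; ∈-filter⁻; ∈-upTo⁺; ∈-upTo⁻; ∈-concatMap⁺; ∈-concatMap⁻; ∈-++⁺ʳ; ∈-∃++)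
open import Data.List.Membership.Propositional.Properties.WithK using (unique∧set⇒bag)
open import Data.List.Relation.Binary.BagAndSetEquality using (∼bag⇒↭)
import Data.List.Relation.Binary.Permutation.Propositional as ↭
open ↭ using (_↭_)
open import Data.List.Relation.Unary.All as All using (All; []; _∷_)
import Data.List.Relation.Unary.All.Properties as All
open import Data.List.Relation.Unary.Any using (here; there)
open import Data.List.Relation.Unary.Unique.Propositional using (Unique; []; _∷_)
import Data.List.Relation.Unary.Unique.Propositional.Properties as Unique
import Data.Maybe as Maybe
open import Data.Nat as ℕ using (zero; suc; _∸_; _≤_; _<_; z≤n; s≤s; _≡ᵇ_; _<ᵇ_; _≤ᵇ_)
import Data.Nat.Properties as ℕₚ
open import Data.List.Membership.DecPropositional ℕₚ._≟_ using (_∈?_)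
open import Data.Nat.Combinatorics using (_C_; nC1≡n; nCk+nC[k+1]≡[n+1]C[k+1]; nCk≡nC[n∸k])
open import Data.Nat.DivMod using (_/_; m*n/n≡m)
open import Data.Nat.Solver using () renaming (module +-*-Solver to ℕ-Solver)
open import Data.Product using (∃-syntax; _,_; proj₁; proj₂)
open import Data.Sum using (_⊎_; inj₁; inj₂)
open import Function using (case_of_)
open import Function.Bundles using (Equivalence; mk⇔)
open import Relation.Nullary using (¬_; yes; no)
open import Relation.Nullary.Decidable using (T?)
open import Relation.Nullary.Decidable.Core using (dec⇒maybe)
import Relation.Binary.PropositionalEquality as ≡
open ≡ using (_≢_; refl; cong; cong₂; subst)

module PowerSeries {c ℓ} (R : CommutativeRing c ℓ) where

  open CommutativeRing R renaming (refl to ≈-refl)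
  open import Relation.Binary.Reasoning.Setoid setoid

  ∑ : ℕ → (ℕ → Carrier) → Carrier
  ∑ zero    f = f 0
  ∑ (suc n) f = ∑ n f + f (suc n)

  ∑-cong≤ : ∀ n {f g} → (∀ i → i ≤ n → f i ≈ g i) → ∑ n f ≈ ∑ n g
  ∑-cong≤ zero    f≈g = f≈g 0 z≤n
  ∑-cong≤ (suc n) f≈g = +-cong (∑-cong≤ n (λ i i≤n → f≈g i (ℕₚ.m≤n⇒m≤1+n i≤n))) (f≈g (suc n) ℕₚ.≤-refl)

  ∑-cong : ∀ n {f g} → (∀ i → f i ≈ g i) → ∑ n f ≈ ∑ n g
  ∑-cong n f≈g = ∑-cong≤ n (λ i _ → f≈g i)

  ∑-distrib-+ : ∀ n f g → ∑ n (λ i → f i + g i) ≈ ∑ n f + ∑ n g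
  ∑-distrib-+ zero    f g = ≈-refl
  ∑-distrib-+ (suc n) f g = trans (+-cong (∑-distrib-+ n f g) ≈-refl)
    (CommutativeSemigroupProperties.interchange +-commutativeSemigroup _ _ _ _)

  *-distribˡ-∑ : ∀ n x f → x * ∑ n f ≈ ∑ n (λ i → x * f i)
  *-distribˡ-∑ zero    x f = ≈-refl
  *-distribˡ-∑ (suc n) x f = trans (distribˡ x _ _) (+-cong (*-distribˡ-∑ n x f) ≈-refl)

  *-distribʳ-∑ : ∀ n x f → ∑ n f * x ≈ ∑ n (λ i → f i * x)
  *-distribʳ-∑ zero    x f = ≈-refl
  *-distribʳ-∑ (suc n) x f = trans (distribʳ x _ _) (+-cong (*-distribʳ-∑ n x f) ≈-refl)

  ∑-zero : ∀ n → ∑ n (λ _ → 0#) ≈ 0#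
  ∑-zero zero    = ≈-refl
  ∑-zero (suc n) = trans (+-identityʳ _) (∑-zero n)

  ∑-unfoldˡ : ∀ n f → ∑ (suc n) f ≈ f 0 + ∑ n (λ i → f (suc i))
  ∑-unfoldˡ zero    f = ≈-refl
  ∑-unfoldˡ (suc n) f = trans (+-cong (∑-unfoldˡ n f) ≈-refl) (+-assoc _ _ _)

  ∑-reverse : ∀ n f → ∑ n f ≈ ∑ n (λ i → f (n ∸ i))
  ∑-reverse zero    f = ≈-refl
  ∑-reverse (suc n) f = begin
    ∑ n f + f (suc n)                      ≈⟨ +-cong (∑-reverse n f) ≈-refl ⟩
    ∑ n (λ i → f (n ∸ i)) + f (suc n)       ≈⟨ +-comm _ _ ⟩
    f (suc n) + ∑ n (λ i → f (suc n ∸ suc i)) ≈⟨ ∑-unfoldˡ n (λ i → f (suc n ∸ i)) ⟨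
    ∑ (suc n) (λ i → f (suc n ∸ i))         ∎

  ∑-triangle : ∀ n (G : ℕ → ℕ → Carrier) →
               ∑ n (λ a → ∑ a (λ c → G c a)) ≈ ∑ n (λ c → ∑ (n ∸ c) (λ e → G c (c ℕ.+ e)))
  ∑-triangle zero    G = ≈-refl
  ∑-triangle (suc n) G = begin
      ∑ n (λ a → ∑ a (λ c → G c a)) + (∑ n (λ c → G c (suc n)) + G (suc n) (suc n))
    ≈⟨ +-cong (∑-triangle n G) ≈-refl ⟩
      ∑ n (λ c → ∑ (n ∸ c) (λ e → G c (c ℕ.+ e))) + (∑ n (λ c → G c (suc n)) + G (suc n) (suc n))
    ≈⟨ +-assoc _ _ _ ⟨
      ∑ n (λ c → ∑ (n ∸ c) (λ e → G c (c ℕ.+ e))) + ∑ n (λ c → G c (suc n)) + G (suc n) (suc n)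
    ≈⟨ +-cong (∑-distrib-+ n _ _) (reflexive (cong (G (suc n)) (ℕₚ.+-identityʳ (suc n)))) ⟨
      ∑ n (λ c → ∑ (n ∸ c) (λ e → G c (c ℕ.+ e)) + G c (suc n)) + G (suc n) (suc n ℕ.+ 0)
    ≈⟨ +-cong (∑-cong≤ n extend) (reflexive (cong (λ m → ∑ m (λ e → G (suc n) (suc n ℕ.+ e))) (ℕₚ.n∸n≡0 n))) ⟨
      ∑ n (λ c → ∑ (suc n ∸ c) (λ e → G c (c ℕ.+ e))) + ∑ (suc n ∸ suc n) (λ e → G (suc n) (suc n ℕ.+ e))
    ∎
    where
    extend : ∀ c → c ≤ n → ∑ (suc n ∸ c) (λ e → G c (c ℕ.+ e)) ≈ ∑ (n ∸ c) (λ e → G c (c ℕ.+ e)) + G c (suc n)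
    extend c c≤n rewrite ℕₚ.+-∸-assoc 1 c≤n =
      +-cong ≈-refl (reflexive (cong (G c) (≡.trans (ℕₚ.+-suc c (n ∸ c)) (cong suc (ℕₚ.m+[n∸m]≡n c≤n)))))

  FormalSeries : Set c
  FormalSeries = ℕ → Carrier

  _≋_ : FormalSeries → FormalSeries → Set ℓ
  f ≋ g = ∀ n → f n ≈ g n

  _⊞_ : FormalSeries → FormalSeries → FormalSeries
  (f ⊞ g) n = f n + g n

  ⊟_ : FormalSeries → FormalSeries
  (⊟ f) n = - f n

  𝟘 : FormalSeries
  𝟘 n = 0#

  𝟙 : FormalSeries
  𝟙 zero    = 1#
  𝟙 (suc n) = 0#

  _⊠_ : FormalSeries → FormalSeries → FormalSeries
  (f ⊠ g) n = ∑ n (λ a → f a * g (n ∸ a))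

  ⊠-cong : ∀ {f f′ g g′} → f ≋ f′ → g ≋ g′ → (f ⊠ g) ≋ (f′ ⊠ g′)
  ⊠-cong f≋f′ g≋g′ n = ∑-cong n (λ a → *-cong (f≋f′ a) (g≋g′ (n ∸ a)))

  ⊠-comm : ∀ f g → (f ⊠ g) ≋ (g ⊠ f)
  ⊠-comm f g n = trans (∑-reverse n _) (∑-cong≤ n (λ i i≤n →
    trans (*-comm _ _) (*-cong (reflexive (cong g (ℕₚ.m∸[m∸n]≡n i≤n))) ≈-refl)))

  ⊠-identityˡ : ∀ f → (𝟙 ⊠ f) ≋ f
  ⊠-identityˡ f zero    = *-identityˡ _
  ⊠-identityˡ f (suc n) = begin
    ∑ (suc n) (λ a → 𝟙 a * f (suc n ∸ a))   ≈⟨ ∑-unfoldˡ n _ ⟩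
    1# * f (suc n) + ∑ n (λ a → 0# * f (n ∸ a)) ≈⟨ +-cong (*-identityˡ _) (∑-cong n (λ a → zeroˡ _)) ⟩
    f (suc n) + ∑ n (λ _ → 0#)              ≈⟨ +-cong ≈-refl (∑-zero n) ⟩
    f (suc n) + 0#                          ≈⟨ +-identityʳ _ ⟩
    f (suc n)                               ∎

  ⊠-identityʳ : ∀ f → (f ⊠ 𝟙) ≋ f
  ⊠-identityʳ f n = trans (⊠-comm f 𝟙 n) (⊠-identityˡ f n)

  ⊠-distribˡ-⊞ : ∀ f g h → (f ⊠ (g ⊞ h)) ≋ ((f ⊠ g) ⊞ (f ⊠ h))
  ⊠-distribˡ-⊞ f g h n = trans (∑-cong n (λ a → distribˡ _ _ _)) (∑-distrib-+ n _ _)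

  ⊠-distribʳ-⊞ : ∀ f g h → ((g ⊞ h) ⊠ f) ≋ ((g ⊠ f) ⊞ (h ⊠ f))
  ⊠-distribʳ-⊞ f g h n = trans (∑-cong n (λ a → distribʳ _ _ _)) (∑-distrib-+ n _ _)

  ⊠-assoc : ∀ f g h → ((f ⊠ g) ⊠ h) ≋ (f ⊠ (g ⊠ h))
  ⊠-assoc f g h n = begin
      ∑ n (λ a → ∑ a (λ c → f c * g (a ∸ c)) * h (n ∸ a))
    ≈⟨ ∑-cong n (λ a → *-distribʳ-∑ a _ _) ⟩
      ∑ n (λ a → ∑ a (λ c → f c * g (a ∸ c) * h (n ∸ a)))
    ≈⟨ ∑-triangle n (λ c a → f c * g (a ∸ c) * h (n ∸ a)) ⟩
      ∑ n (λ c → ∑ (n ∸ c) (λ e → f c * g (c ℕ.+ e ∸ c) * h (n ∸ (c ℕ.+ e))))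
    ≈⟨ ∑-cong n (λ c → ∑-cong (n ∸ c) (λ e → trans (*-assoc _ _ _)
         (*-cong ≈-refl (*-cong (reflexive (cong g (ℕₚ.m+n∸m≡n c e)))
                              (reflexive (cong h (≡.sym (ℕₚ.∸-+-assoc n c e)))))))) ⟩
      ∑ n (λ c → ∑ (n ∸ c) (λ e → f c * (g e * h (n ∸ c ∸ e))))
    ≈⟨ ∑-cong n (λ c → *-distribˡ-∑ (n ∸ c) _ _) ⟨
      ∑ n (λ c → f c * ∑ (n ∸ c) (λ e → g e * h (n ∸ c ∸ e)))
    ∎

  formalSeries-isCommutativeRing : IsCommutativeRing _≋_ _⊞_ _⊠_ ⊟_ 𝟘 𝟙
  formalSeries-isCommutativeRing = record
    { isRing = record
      { +-isAbelianGroup = Pointwise.isAbelianGroup ℕ +-isAbelianGroup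
      ; *-cong           = ⊠-cong
      ; *-assoc          = ⊠-assoc
      ; *-identity       = ⊠-identityˡ , ⊠-identityʳ
      ; distrib          = ⊠-distribˡ-⊞ , ⊠-distribʳ-⊞
      }
    ; *-comm = ⊠-comm
    }

  formalSeriesRing : CommutativeRing c ℓ
  formalSeriesRing = record { isCommutativeRing = formalSeries-isCommutativeRing }

module _ {c ℓ} (R : CommutativeRing c ℓ) where

  open CommutativeRing R renaming (refl to ≈-refl)

  replaceMultiplication : (_*′_ : Carrier → Carrier → Carrier) (1′ : Carrier) →
                          (∀ x y → (x *′ y) ≈ (x * y)) → 1′ ≈ 1# → CommutativeRing c ℓ
  replaceMultiplication _*′_ 1′ *′≈* 1′≈1 = record
    { isCommutativeRing = record
      { isRing = record
        { +-isAbelianGroup = +-isAbelianGroup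
        ; *-cong     = λ {x} {y} {u} {v} x≈y u≈v →
                         trans (*′≈* x u) (trans (*-cong x≈y u≈v) (sym (*′≈* y v)))
        ; *-assoc    = λ x y z → trans (*′≈* _ z) (trans (*-cong (*′≈* x y) ≈-refl) (trans (*-assoc x y z)
                         (trans (*-cong ≈-refl (sym (*′≈* y z))) (sym (*′≈* x _)))))
        ; *-identity = (λ x → trans (*′≈* 1′ x) (trans (*-cong 1′≈1 ≈-refl) (*-identityˡ x)))
                     , (λ x → trans (*′≈* x 1′) (trans (*-cong ≈-refl 1′≈1) (*-identityʳ x)))
        ; distrib    = (λ x y z → trans (*′≈* x _) (trans (distribˡ x y z) (+-cong (sym (*′≈* x y)) (sym (*′≈* x z)))))
                     , (λ x y z → trans (*′≈* _ x) (trans (distribʳ x y z) (+-cong (sym (*′≈* y x)) (sym (*′≈* z x)))))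
        }
      ; *-comm = λ x y → trans (*′≈* x y) (trans (*-comm x y) (sym (*′≈* y x)))
      }
    }

module SumTo where

  module ℤ[[y]] = PowerSeries ℤₚ.+-*-commutativeRing
  open ℤ[[y]] using (∑)

  sumTo≡∑ : ∀ n f → sumTo n f ≡ ∑ n f
  sumTo≡∑ zero    f = refl
  sumTo≡∑ (suc n) f = cong (ℤ._+ f (suc n)) (sumTo≡∑ n f)

  sumTo-cong≤ : ∀ n {f g} → (∀ i → i ≤ n → f i ≡ g i) → sumTo n f ≡ sumTo n g
  sumTo-cong≤ n {f} {g} f≡g = ≡.trans (sumTo≡∑ n f) (≡.trans (ℤ[[y]].∑-cong≤ n f≡g) (≡.sym (sumTo≡∑ n g)))

  sumTo-cong : ∀ n {f g} → (∀ i → f i ≡ g i) → sumTo n f ≡ sumTo n g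
  sumTo-cong n f≡g = sumTo-cong≤ n (λ i _ → f≡g i)

  sumTo-distrib-+ : ∀ n f g → sumTo n (λ i → f i ℤ.+ g i) ≡ sumTo n f ℤ.+ sumTo n g
  sumTo-distrib-+ n f g = ≡.trans (sumTo≡∑ n _)
    (≡.trans (ℤ[[y]].∑-distrib-+ n f g) (≡.sym (cong₂ ℤ._+_ (sumTo≡∑ n f) (sumTo≡∑ n g))))

  *-distribˡ-sumTo : ∀ n c f → c ℤ.* sumTo n f ≡ sumTo n (λ i → c ℤ.* f i)
  *-distribˡ-sumTo n c f = ≡.trans (cong (c ℤ.*_) (sumTo≡∑ n f))
    (≡.trans (ℤ[[y]].*-distribˡ-∑ n c f) (≡.sym (sumTo≡∑ n _)))

  sumTo-unfoldˡ : ∀ n f → sumTo (suc n) f ≡ f 0 ℤ.+ sumTo n (λ i → f (suc i))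
  sumTo-unfoldˡ n f = ≡.trans (sumTo≡∑ (suc n) f)
    (≡.trans (ℤ[[y]].∑-unfoldˡ n f) (cong (λ s → f 0 ℤ.+ s) (≡.sym (sumTo≡∑ n _))))

  sumTo-zero : ∀ n f → (∀ i → f i ≡ + 0) → sumTo n f ≡ + 0
  sumTo-zero zero    f f≡0 = f≡0 0
  sumTo-zero (suc n) f f≡0 = cong₂ ℤ._+_ (sumTo-zero n f f≡0) (f≡0 (suc n))

  sumTo-head : ∀ n f → (∀ i → f (suc i) ≡ + 0) → sumTo n f ≡ f 0
  sumTo-head zero    f _     = refl
  sumTo-head (suc n) f f+≡0 = ≡.trans (cong₂ ℤ._+_ (sumTo-head n f f+≡0) (f+≡0 n)) (ℤₚ.+-identityʳ _)

  sumTo-neg : ∀ n f → sumTo n (λ i → ℤ.- f i) ≡ ℤ.- sumTo n f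
  sumTo-neg zero    f = refl
  sumTo-neg (suc n) f =
    ≡.trans (cong (ℤ._+ (ℤ.- f (suc n))) (sumTo-neg n f)) (≡.sym (ℤₚ.neg-distrib-+ (sumTo n f) _))

  sumTo-if : ∀ n (b : Bool) f → sumTo n (λ i → if b then f i else + 0) ≡ (if b then sumTo n f else + 0)
  sumTo-if n true  f = refl
  sumTo-if n false f = sumTo-zero n _ (λ _ → refl)

module Bivariate where

  open SumTo
  module ℤ[[y]][[x]] = PowerSeries ℤ[[y]].formalSeriesRing

  sumTo≡∑ˣ : ∀ n (F : ℕ → ℕ → ℤ) j → sumTo n (λ a → F a j) ≡ ℤ[[y]][[x]].∑ n F j
  sumTo≡∑ˣ zero    F j = refl
  sumTo≡∑ˣ (suc n) F j = cong (ℤ._+ F (suc n) j) (sumTo≡∑ˣ n F j)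

  ⊗≡⊠ : ∀ f g n j → (f ⊗ g) n j ≡ ℤ[[y]][[x]]._⊠_ f g n j
  ⊗≡⊠ f g n j = ≡.trans (sumTo-cong n (λ a → sumTo≡∑ j _)) (sumTo≡∑ˣ n _ j)

  one≡𝟙 : ∀ n j → const (+ 1) n j ≡ ℤ[[y]][[x]].𝟙 n j
  one≡𝟙 zero    zero    = refl
  one≡𝟙 zero    (suc j) = refl
  one≡𝟙 (suc n) zero    = refl
  one≡𝟙 (suc n) (suc j) = refl

  -- ℤ[[x, y]] is built as (ℤ[[y]])[[x]]; its product agrees coefficientwise with _⊗_, which is
  -- installed as the multiplication so that the ring solver works with _⊗_ directly.
  seriesRing : CommutativeRing _ _
  seriesRing = replaceMultiplication ℤ[[y]][[x]].formalSeriesRing _⊗_ (const (+ 1)) ⊗≡⊠ one≡𝟙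

  module 𝕊 = CommutativeRing seriesRing
  open 𝕊 public using (_≈_)

  const⊗ : ∀ a f n j → (const a ⊗ f) n j ≡ a ℤ.* f n j
  const⊗ a f n j = ≡.trans (sumTo-head n _ (λ _ → sumTo-zero j _ (λ _ → refl))) (sumTo-head j _ (λ _ → refl))

  X⊗-zero : ∀ f j → (X ⊗ f) 0 j ≡ + 0
  X⊗-zero f j = sumTo-zero j _ (λ _ → refl)

  X⊗-suc : ∀ f n j → (X ⊗ f) (suc n) j ≡ f n j
  X⊗-suc f n j = begin
    (X ⊗ f) (suc n) j                                         ≡⟨ sumTo-unfoldˡ n _ ⟩
    sumTo j (λ b → X 0 b ℤ.* f (suc n) (j ∸ b)) ℤ.+
    sumTo n (λ a → sumTo j (λ b → X (suc a) b ℤ.* f (n ∸ a) (j ∸ b)))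
      ≡⟨ cong₂ ℤ._+_ (sumTo-zero j _ (λ _ → refl)) (sumTo-head n _ (λ _ → sumTo-zero j _ (λ _ → refl))) ⟩
    + 0 ℤ.+ sumTo j (λ b → X 1 b ℤ.* f n (j ∸ b))               ≡⟨ ℤₚ.+-identityˡ _ ⟩
    sumTo j (λ b → X 1 b ℤ.* f n (j ∸ b))                      ≡⟨ sumTo-head j _ (λ _ → refl) ⟩
    + 1 ℤ.* f n j                                              ≡⟨ ℤₚ.*-identityˡ _ ⟩
    f n j                                                      ∎
    where open ≡.≡-Reasoning

  timesY : (ℕ → ℤ) → ℕ → ℤ
  timesY f zero    = + 0
  timesY f (suc j) = f j

  Y⊗ : ∀ f n j → (Y ⊗ f) n j ≡ timesY (f n) j
  Y⊗ f n j = ≡.trans (sumTo-head n _ (λ _ → sumTo-zero j _ (λ _ → refl))) (onX⁰ j)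
    where
    onX⁰ : ∀ j → sumTo j (λ b → Y 0 b ℤ.* f n (j ∸ b)) ≡ timesY (f n) j
    onX⁰ zero    = refl
    onX⁰ (suc j) = ≡.trans (sumTo-unfoldˡ j _) (≡.trans (ℤₚ.+-identityˡ _)
                     (≡.trans (sumTo-head j _ (λ _ → refl)) (ℤₚ.*-identityˡ _)))

  timesY-cong : ∀ {f g : ℕ → ℤ} → (∀ j → f j ≡ g j) → ∀ j → timesY f j ≡ timesY g j
  timesY-cong f≡g zero    = refl
  timesY-cong f≡g (suc j) = f≡g j

  timesY-sumTo : ∀ n (F : ℕ → ℕ → ℤ) j → timesY (λ j′ → sumTo n (F j′)) j ≡ sumTo n (λ m → timesY (λ j′ → F j′ m) j)
  timesY-sumTo n F zero    = ≡.sym (sumTo-zero n _ (λ _ → refl))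
  timesY-sumTo n F (suc j) = refl

  const-morphism : CommutativeRing.rawRing ℤₚ.+-*-commutativeRing -Raw-AlmostCommutative⟶ fromCommutativeRing seriesRing
  const-morphism = record
    { ⟦_⟧    = const
    ; +-homo = λ a b → λ { zero zero → refl ; zero (suc j) → refl ; (suc n) zero → refl ; (suc n) (suc j) → refl }
    ; *-homo = λ a b n j → ≡.trans (const-* a b n j) (≡.sym (const⊗ a (const b) n j))
    ; -‿homo = λ a → λ { zero zero → refl ; zero (suc j) → refl ; (suc n) zero → refl ; (suc n) (suc j) → refl }
    ; 0-homo = λ { zero zero → refl ; zero (suc j) → refl ; (suc n) zero → refl ; (suc n) (suc j) → refl }
    ; 1-homo = λ n j → refl
    }
    where
    const-* : ∀ a b n j → const (a ℤ.* b) n j ≡ a ℤ.* const b n j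
    const-* a b zero    zero    = refl
    const-* a b zero    (suc j) = ≡.sym (ℤₚ.*-zeroʳ a)
    const-* a b (suc n) zero    = ≡.sym (ℤₚ.*-zeroʳ a)
    const-* a b (suc n) (suc j) = ≡.sym (ℤₚ.*-zeroʳ a)

  const-≟ : ∀ a b → Maybe.Maybe (const a ≈ const b)
  const-≟ a b = Maybe.map (λ { refl → 𝕊.refl }) (dec⇒maybe (a ℤₚ.≟ b))

  module Solver = Algebra.Solver.Ring _ _ const-morphism const-≟

module Derivative where

  open SumTo
  open Bivariate

  ∂ : Series → Series
  ∂ f n j = + suc n ℤ.* f (suc n) j

  ∂-cong : ∀ {f g} → f ≈ g → ∂ f ≈ ∂ g
  ∂-cong f≈g n j = cong (+ suc n ℤ.*_) (f≈g (suc n) j)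

  ∂-⊕ : ∀ f g → ∂ (f ⊕ g) ≈ ∂ f ⊕ ∂ g
  ∂-⊕ f g n j = ℤₚ.*-distribˡ-+ (+ suc n) (f (suc n) j) (g (suc n) j)

  ∂-neg : ∀ f → ∂ (𝕊.- f) ≈ 𝕊.- ∂ f
  ∂-neg f n j = ≡.sym (ℤₚ.neg-distribʳ-* (+ suc n) _)

  ∂-const : ∀ c → ∂ (const c) ≈ 𝕊.0#
  ∂-const c n j = ℤₚ.*-zeroʳ (+ suc n)

  ∂-X : ∂ X ≈ const (+ 1)
  ∂-X zero    zero    = refl
  ∂-X zero    (suc j) = refl
  ∂-X (suc n) zero    = ℤₚ.*-zeroʳ (+ suc (suc n))
  ∂-X (suc n) (suc j) = ℤₚ.*-zeroʳ (+ suc (suc n))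

  -- Split the weight n + 1 of the term x^a · x^(n+1−a) as a + (n + 1 − a).
  ∂-⊗ : ∀ f g → ∂ (f ⊗ g) ≈ ∂ f ⊗ g ⊕ f ⊗ ∂ g
  ∂-⊗ f g n j = begin
      + suc n ℤ.* sumTo (suc n) term
    ≡⟨ *-distribˡ-sumTo (suc n) (+ suc n) term ⟩
      sumTo (suc n) (λ a → + suc n ℤ.* term a)
    ≡⟨ sumTo-cong≤ (suc n) (λ a a≤ → ≡.trans (cong (λ z → + z ℤ.* term a) (≡.sym (ℕₚ.m+[n∸m]≡n a≤)))
         (≡.trans (cong (ℤ._* term a) (≡.sym (ℤₚ.pos-+ a (suc n ∸ a))))
                  (ℤₚ.*-distribʳ-+ (term a) (+ a) (+ (suc n ∸ a))))) ⟩
      sumTo (suc n) (λ a → + a ℤ.* term a ℤ.+ + (suc n ∸ a) ℤ.* term a)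
    ≡⟨ sumTo-distrib-+ (suc n) _ _ ⟩
      sumTo (suc n) (λ a → + a ℤ.* term a) ℤ.+ sumTo (suc n) (λ a → + (suc n ∸ a) ℤ.* term a)
    ≡⟨ cong₂ ℤ._+_ left right ⟩
      (∂ f ⊗ g) n j ℤ.+ (f ⊗ ∂ g) n j
    ∎
    where
    open ≡.≡-Reasoning
    term : ℕ → ℤ
    term a = sumTo j (λ b → f a b ℤ.* g (suc n ∸ a) (j ∸ b))
    left : sumTo (suc n) (λ a → + a ℤ.* term a) ≡ (∂ f ⊗ g) n j
    left = ≡.trans (sumTo-unfoldˡ n _) (≡.trans (ℤₚ.+-identityˡ _)
      (sumTo-cong n (λ a → ≡.trans (*-distribˡ-sumTo j (+ suc a) _)
        (sumTo-cong j (λ b → ≡.sym (ℤₚ.*-assoc (+ suc a) (f (suc a) b) _))))))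
    right : sumTo (suc n) (λ a → + (suc n ∸ a) ℤ.* term a) ≡ (f ⊗ ∂ g) n j
    right = ≡.trans (cong (λ z → sumTo n (λ a → + (suc n ∸ a) ℤ.* term a) ℤ.+ + z ℤ.* term (suc n)) (ℕₚ.n∸n≡0 n))
      (≡.trans (ℤₚ.+-identityʳ _)
      (sumTo-cong≤ n (λ a a≤n → ≡.trans (*-distribˡ-sumTo j (+ (suc n ∸ a)) _) (sumTo-cong j (λ b →
        ≡.trans (cong (λ z → + z ℤ.* (f a b ℤ.* g z (j ∸ b))) (ℕₚ.+-∸-assoc 1 a≤n))
                (x∙yz≈y∙xz (+ suc (n ∸ a)) (f a b) (g (suc (n ∸ a)) (j ∸ b))))))))
      where open CommutativeSemigroupProperties ℤₚ.*-commutativeSemigroup using (x∙yz≈y∙xz)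

module ListFacts where

  take-length-++ : ∀ {A : Set} (xs ys : List A) → take (length xs) (xs ++ ys) ≡ xs
  take-length-++ []       ys = refl
  take-length-++ (x ∷ xs) ys = cong (x ∷_) (take-length-++ xs ys)

  drop-length-++ : ∀ {A : Set} (xs ys : List A) → drop (length xs) (xs ++ ys) ≡ ys
  drop-length-++ []       ys = refl
  drop-length-++ (x ∷ xs) ys = drop-length-++ xs ys

  ∈-drop : ∀ {x : ℕ} k xs → x ∈ drop k xs → x ∈ xs
  ∈-drop zero    xs       x∈ = x∈
  ∈-drop (suc k) (y ∷ xs) x∈ = there (∈-drop k xs x∈)

  take-++-∷ : ∀ K (A B : List ℕ) → length A < K → take K (A ++ 1 ∷ B) ≡ A ++ 1 ∷ take (K ∸ suc (length A)) B
  take-++-∷ (suc K) []      B _         = refl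
  take-++-∷ (suc K) (a ∷ A) B (s≤s |A|<K) = cong (a ∷_) (take-++-∷ K A B |A|<K)

  take-++-short : ∀ K (A B : List ℕ) → K ≤ length A → take K (A ++ B) ≡ take K A
  take-++-short zero    A       B _          = refl
  take-++-short (suc K) (a ∷ A) B (s≤s K≤|A|) = cong (a ∷_) (take-++-short K A B K≤|A|)

  length-take-≡ : ∀ j (B : List ℕ) → length (take j B) ≡ j → j ≤ length B
  length-take-≡ zero    B       _  = z≤n
  length-take-≡ (suc j) (b ∷ B) eq = s≤s (length-take-≡ j B (ℕₚ.suc-injective eq))

  length-take-≤ : ∀ j (B : List ℕ) → j ≤ length B → length (take j B) ≡ j
  length-take-≤ zero    B       _        = refl
  length-take-≤ (suc j) (b ∷ B) (s≤s j≤) = cong suc (length-take-≤ j B j≤)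

module UniqueLists where

  module _ {A : Set} where

    Unique-++⁻ˡ : ∀ (xs : List A) {ys} → Unique (xs ++ ys) → Unique xs
    Unique-++⁻ˡ []       _          = []
    Unique-++⁻ˡ (x ∷ xs) (x∉ ∷ !xs) = All.++⁻ˡ xs x∉ ∷ Unique-++⁻ˡ xs !xs

    Unique-++⁻ʳ : ∀ (xs : List A) {ys} → Unique (xs ++ ys) → Unique ys
    Unique-++⁻ʳ []       !ys       = !ys
    Unique-++⁻ʳ (x ∷ xs) (_ ∷ !xs) = Unique-++⁻ʳ xs !xs

    Unique-++⇒disjoint : ∀ (xs : List A) {ys x y} → Unique (xs ++ ys) → x ∈ xs → y ∈ ys → x ≢ y
    Unique-++⇒disjoint (x ∷ xs) (x∉ ∷ _)   (here refl) y∈ = All.lookup x∉ (∈-++⁺ʳ xs y∈)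
    Unique-++⇒disjoint (x ∷ xs) (_  ∷ !xs) (there x∈)  y∈ = Unique-++⇒disjoint xs !xs x∈ y∈

    Unique-remove : ∀ (xs : List A) {v ys} → Unique (xs ++ v ∷ ys) → Unique (xs ++ ys) × All (v ≢_) (xs ++ ys)
    Unique-remove []       (v∉ ∷ !ys) = !ys , v∉
    Unique-remove (x ∷ xs) (x∉ ∷ !rest) with Unique-remove xs !rest
    ... | !xs++ys , v∉ with All.++⁻ xs x∉
    ...   | x∉xs , x≢v ∷ x∉ys = (All.++⁺ x∉xs x∉ys ∷ !xs++ys) , ((λ v≡x → x≢v (≡.sym v≡x)) ∷ v∉)

  module _ {A B : Set} (f : A → List B) where

    Unique-concatMap⁺ : ∀ {xs} → Unique xs → (∀ x → x ∈ xs → Unique (f x)) →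
      (∀ {x x′ y} → x ∈ xs → x′ ∈ xs → y ∈ f x → y ∈ f x′ → x ≡ x′) → Unique (concatMap f xs)
    Unique-concatMap⁺ {[]}     _          _   _        = []
    Unique-concatMap⁺ {x ∷ xs} (x∉ ∷ !xs) !fx disjoint =
      Unique.++⁺ (!fx x (here refl))
                 (Unique-concatMap⁺ !xs (λ y y∈ → !fx y (there y∈)) (λ p q → disjoint (there p) (there q)))
                 (λ (y∈fx , y∈rest) → let (x′ , x′∈ , y∈fx′) = find (∈-concatMap⁻ f y∈rest)
                                       in All.lookup x∉ x′∈ (disjoint (here refl) (there x′∈) y∈fx y∈fx′))

  private
    narrow : ∀ {lo hi a} → (lo ≤ a × a < suc hi) × (hi ≢ a) → lo ≤ a × a < hi
    narrow ((lo≤a , a≤hi) , hi≢a) = lo≤a , ℕₚ.≤∧≢⇒< (ℕₚ.≤-pred a≤hi) (λ a≡hi → hi≢a (≡.sym a≡hi))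

  Unique-between⇒length≤ : ∀ hi lo (w : List ℕ) → Unique w → All (λ a → lo ≤ a × a < hi) w → length w ≤ hi ∸ lo
  Unique-between⇒length≤ zero     lo []      _  _                = z≤n
  Unique-between⇒length≤ zero     lo (a ∷ w) _  ((_ , ()) ∷ _)
  Unique-between⇒length≤ (suc hi) lo w       !w bounds with hi ∈? w
  ... | no hi∉w = ℕₚ.≤-trans (Unique-between⇒length≤ hi lo w !w (All.zipWith narrow (bounds , All.¬Any⇒All¬ w hi∉w)))
                             (ℕₚ.∸-monoˡ-≤ lo (ℕₚ.n≤1+n hi))
  ... | yes hi∈w with ∈-∃++ hi∈w
  ... | xs , ys , refl with Unique-remove xs !w
  ... | !xs++ys , hi∉ = begin
      length (xs ++ hi ∷ ys)   ≡⟨ List.length-++-sucʳ xs hi ys ⟩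
      suc (length (xs ++ ys))  ≤⟨ s≤s (Unique-between⇒length≤ hi lo (xs ++ ys) !xs++ys
                                        (All.zipWith narrow (rest , hi∉))) ⟩
      suc (hi ∸ lo)            ≡⟨ ℕₚ.+-∸-assoc 1 (proj₁ (All.lookup bounds hi∈w)) ⟨
      suc hi ∸ lo              ∎
    where
    open ℕₚ.≤-Reasoning
    rest : All (λ a → lo ≤ a × a < suc hi) (xs ++ ys)
    rest = All.++⁺ (All.++⁻ˡ xs bounds) (All.tail (All.++⁻ʳ xs bounds))

module ListSum where

  open SumTo

  sumOver : {A : Set} → List A → (A → ℤ) → ℤ
  sumOver []       f = + 0
  sumOver (x ∷ xs) f = f x ℤ.+ sumOver xs f

  indicator : Bool → ℤ
  indicator b = if b then + 1 else + 0

  module _ {A : Set} where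

    sumOver-++ : ∀ (xs ys : List A) f → sumOver (xs ++ ys) f ≡ sumOver xs f ℤ.+ sumOver ys f
    sumOver-++ []       ys f = ≡.sym (ℤₚ.+-identityˡ _)
    sumOver-++ (x ∷ xs) ys f = ≡.trans (cong (ℤ._+_ (f x)) (sumOver-++ xs ys f)) (≡.sym (ℤₚ.+-assoc (f x) _ _))

    sumOver-cong∈ : ∀ (xs : List A) {f g} → (∀ x → x ∈ xs → f x ≡ g x) → sumOver xs f ≡ sumOver xs g
    sumOver-cong∈ []       f≡g = refl
    sumOver-cong∈ (x ∷ xs) f≡g = cong₂ ℤ._+_ (f≡g x (here refl)) (sumOver-cong∈ xs (λ y y∈ → f≡g y (there y∈)))

    sumOver-cong : ∀ (xs : List A) {f g} → (∀ x → f x ≡ g x) → sumOver xs f ≡ sumOver xs g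
    sumOver-cong xs f≡g = sumOver-cong∈ xs (λ x _ → f≡g x)

    *-distribˡ-sumOver : ∀ (xs : List A) c f → c ℤ.* sumOver xs f ≡ sumOver xs (λ x → c ℤ.* f x)
    *-distribˡ-sumOver []       c f = ℤₚ.*-zeroʳ c
    *-distribˡ-sumOver (x ∷ xs) c f =
      ≡.trans (ℤₚ.*-distribˡ-+ c (f x) _) (cong (ℤ._+_ (c ℤ.* f x)) (*-distribˡ-sumOver xs c f))

    *-distribʳ-sumOver : ∀ (xs : List A) c f → sumOver xs f ℤ.* c ≡ sumOver xs (λ x → f x ℤ.* c)
    *-distribʳ-sumOver xs c f = ≡.trans (ℤₚ.*-comm _ c)
      (≡.trans (*-distribˡ-sumOver xs c f) (sumOver-cong xs (λ x → ℤₚ.*-comm c (f x))))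

    sumOver-zero : ∀ (xs : List A) f → (∀ x → f x ≡ + 0) → sumOver xs f ≡ + 0
    sumOver-zero []       f f≡0 = refl
    sumOver-zero (x ∷ xs) f f≡0 = cong₂ ℤ._+_ (f≡0 x) (sumOver-zero xs f f≡0)

    sumOver-sumTo : ∀ (xs : List A) n (F : A → ℕ → ℤ) →
                    sumOver xs (λ x → sumTo n (F x)) ≡ sumTo n (λ i → sumOver xs (λ x → F x i))
    sumOver-sumTo []       n F = ≡.sym (sumTo-zero n _ (λ _ → refl))
    sumOver-sumTo (x ∷ xs) n F = ≡.trans (cong (ℤ._+_ (sumTo n (F x))) (sumOver-sumTo xs n F))
                                         (≡.sym (sumTo-distrib-+ n (F x) _))

    sumOver-↭ : ∀ {xs ys : List A} f → xs ↭ ys → sumOver xs f ≡ sumOver ys f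
    sumOver-↭ f ↭.refl         = refl
    sumOver-↭ f (↭.prep x p)   = cong (ℤ._+_ (f x)) (sumOver-↭ f p)
    sumOver-↭ f (↭.swap x y p) = ≡.trans (≡.sym (ℤₚ.+-assoc (f x) (f y) _))
      (≡.trans (cong₂ ℤ._+_ (ℤₚ.+-comm (f x) (f y)) (sumOver-↭ f p)) (ℤₚ.+-assoc (f y) (f x) _))
    sumOver-↭ f (↭.trans p q)  = ≡.trans (sumOver-↭ f p) (sumOver-↭ f q)

    sumOver-sameElements : ∀ {xs ys : List A} f → Unique xs → Unique ys →
                           (∀ {z} → z ∈ xs → z ∈ ys) → (∀ {z} → z ∈ ys → z ∈ xs) → sumOver xs f ≡ sumOver ys f
    sumOver-sameElements f !xs !ys xs⊆ys ys⊆xs = sumOver-↭ f (∼bag⇒↭ (unique∧set⇒bag !xs !ys (mk⇔ xs⊆ys ys⊆xs)))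

    length≡sumOver-1 : ∀ (xs : List A) → + length xs ≡ sumOver xs (λ _ → + 1)
    length≡sumOver-1 []       = refl
    length≡sumOver-1 (x ∷ xs) = cong (ℤ._+_ (+ 1)) (length≡sumOver-1 xs)

    length-filter-∧ : ∀ (xs : List A) (p q : A → Bool) →
      + length (filter (λ x → T? (p x ∧ q x)) xs) ≡ sumOver (filter (λ x → T? (p x)) xs) (λ x → indicator (q x))
    length-filter-∧ []       p q = refl
    length-filter-∧ (x ∷ xs) p q with p x
    ... | false = length-filter-∧ xs p q
    ... | true with q x
    ...   | false = ≡.trans (length-filter-∧ xs p q) (≡.sym (ℤₚ.+-identityˡ _))
    ...   | true  = cong (ℤ._+_ (+ 1)) (length-filter-∧ xs p q)

  module _ {A B : Set} (f : A → List B) where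

    sumOver-concatMap : ∀ xs g → sumOver (concatMap f xs) g ≡ sumOver xs (λ x → sumOver (f x) g)
    sumOver-concatMap []       g = refl
    sumOver-concatMap (x ∷ xs) g =
      ≡.trans (sumOver-++ (f x) (concatMap f xs) g) (cong (ℤ._+_ (sumOver (f x) g)) (sumOver-concatMap xs g))

  sumOver-map : ∀ {A B : Set} (f : A → B) xs g → sumOver (map f xs) g ≡ sumOver xs (λ x → g (f x))
  sumOver-map f []       g = refl
  sumOver-map f (x ∷ xs) g = cong (ℤ._+_ (g (f x))) (sumOver-map f xs g)

  sumOver-applyUpTo : ∀ n (f : ℕ → ℕ) g → sumOver (applyUpTo f (suc n)) g ≡ sumTo n (λ i → g (f i))
  sumOver-applyUpTo zero    f g = ℤₚ.+-identityʳ _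
  sumOver-applyUpTo (suc n) f g = ≡.trans (cong (ℤ._+_ (g (f 0))) (sumOver-applyUpTo n (λ i → f (suc i)) g))
                                          (≡.sym (sumTo-unfoldˡ n (λ i → g (f i))))

  sumOver-upTo : ∀ n g → sumOver (upTo (suc n)) g ≡ sumTo n g
  sumOver-upTo n g = sumOver-applyUpTo n (λ i → i) g

module NatBool where

  T⇒≡true : ∀ {b} → T b → b ≡ true
  T⇒≡true = Equivalence.to T-≡

  ≡true⇒T : ∀ {b} → b ≡ true → T b
  ≡true⇒T = Equivalence.from T-≡

  ≡ᵇ-true⇒≡ : ∀ {m n} → (m ≡ᵇ n) ≡ true → m ≡ n
  ≡ᵇ-true⇒≡ {m} {n} eq = ℕₚ.≡ᵇ⇒≡ m n (≡true⇒T eq)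

  ≡⇒≡ᵇ-true : ∀ {m n} → m ≡ n → (m ≡ᵇ n) ≡ true
  ≡⇒≡ᵇ-true {m} {n} eq = T⇒≡true (ℕₚ.≡⇒≡ᵇ m n eq)

  <ᵇ-true⇒< : ∀ {m n} → (m <ᵇ n) ≡ true → m < n
  <ᵇ-true⇒< {m} {n} eq = ℕₚ.<ᵇ⇒< m n (≡true⇒T eq)

  <⇒<ᵇ-true : ∀ {m n} → m < n → (m <ᵇ n) ≡ true
  <⇒<ᵇ-true m<n = T⇒≡true (ℕₚ.<⇒<ᵇ m<n)

  ≮⇒<ᵇ-false : ∀ {m n} → ¬ m < n → (m <ᵇ n) ≡ false
  ≮⇒<ᵇ-false m≮n = ¬-not (λ eq → m≮n (<ᵇ-true⇒< eq))

  ≤ᵇ-true⇒≤ : ∀ {m n} → (m ≤ᵇ n) ≡ true → m ≤ n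
  ≤ᵇ-true⇒≤ {m} {n} eq = ℕₚ.≤ᵇ⇒≤ m n (≡true⇒T eq)

  ≤⇒≤ᵇ-true : ∀ {m n} → m ≤ n → (m ≤ᵇ n) ≡ true
  ≤⇒≤ᵇ-true m≤n = T⇒≡true (ℕₚ.≤⇒≤ᵇ m≤n)

  ≤ᵇ-false⇒> : ∀ {m n} → (m ≤ᵇ n) ≡ false → n < m
  ≤ᵇ-false⇒> eq = ℕₚ.≰⇒> (λ m≤n → case ≡.trans (≡.sym (≤⇒≤ᵇ-true m≤n)) eq of λ ())

module Avoiders where

  open NatBool
  open UniqueLists using (Unique-concatMap⁺)

  Letter : ℕ → ℕ → Set
  Letter m a = 1 ≤ a × a ≤ m

  ∈-letters⁺ : ∀ {m a} → Letter m a → a ∈ map suc (upTo m)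
  ∈-letters⁺ {m} {suc a} (_ , a<m) = ∈-map⁺ suc (∈-upTo⁺ a<m)

  ∈-letters⁻ : ∀ {m a} → a ∈ map suc (upTo m) → Letter m a
  ∈-letters⁻ a∈ with ∈-map⁻ suc a∈
  ... | _ , i∈ , refl = s≤s z≤n , ∈-upTo⁻ i∈

  private
    prepend : ℕ → List ℕ → List (List ℕ)
    prepend m w = map (λ a → a ∷ w) (map suc (upTo m))

  ∈-words⁻ : ∀ m n {w} → w ∈ words m n → length w ≡ n × All (Letter m) w
  ∈-words⁻ m zero    (here refl) = refl , []
  ∈-words⁻ m (suc n) w∈ with find (∈-concatMap⁻ (prepend m) {words m n} w∈)
  ... | v , v∈ , w∈′ with ∈-map⁻ (λ a → a ∷ v) w∈′
  ... | a , a∈ , refl with ∈-words⁻ m n v∈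
  ... | |v|≡n , letters = cong suc |v|≡n , ∈-letters⁻ a∈ ∷ letters

  ∈-words⁺ : ∀ m n {w} → length w ≡ n → All (Letter m) w → w ∈ words m n
  ∈-words⁺ m zero    {[]}    _     _              = here refl
  ∈-words⁺ m (suc n) {a ∷ w} |w|≡ (a-ok ∷ letters) =
    ∈-concatMap⁺ (prepend m) (lose (∈-words⁺ m n (ℕₚ.suc-injective |w|≡) letters)
                                   (∈-map⁺ (λ a → a ∷ w) (∈-letters⁺ a-ok)))

  words-unique : ∀ m n → Unique (words m n)
  words-unique m zero    = [] ∷ []
  words-unique m (suc n) = Unique-concatMap⁺ (prepend m) (words-unique m n)
    (λ w _ → Unique.map⁺ List.∷-injectiveˡ (Unique.map⁺ ℕₚ.suc-injective (Unique.upTo⁺ m)))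
    (λ _ _ → sameTail)
    where
    sameTail : ∀ {v v′ w} → w ∈ prepend m v → w ∈ prepend m v′ → v ≡ v′
    sameTail w∈ w∈′ with ∈-map⁻ _ w∈ | ∈-map⁻ _ w∈′
    ... | _ , _ , refl | _ , _ , eq = List.∷-injectiveʳ eq

  notAny≡⇒All≢ : ∀ a w → not (any (a ≡ᵇ_) w) ≡ true → All (a ≢_) w
  notAny≡⇒All≢ a []      _  = []
  notAny≡⇒All≢ a (b ∷ w) eq with a ≡ᵇ b in a≡ᵇb
  ... | false = (λ a≡b → case ≡.trans (≡.sym (≡⇒≡ᵇ-true a≡b)) a≡ᵇb of λ ()) ∷ notAny≡⇒All≢ a w eq

  All≢⇒notAny≡ : ∀ a w → All (a ≢_) w → not (any (a ≡ᵇ_) w) ≡ true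
  All≢⇒notAny≡ a []      _           = refl
  All≢⇒notAny≡ a (b ∷ w) (a≢b ∷ a∉w) with a ≡ᵇ b in a≡ᵇb
  ... | false = All≢⇒notAny≡ a w a∉w
  ... | true  = ⊥-elim (a≢b (≡ᵇ-true⇒≡ a≡ᵇb))

  distinct⇒Unique : ∀ w → distinct w ≡ true → Unique w
  distinct⇒Unique []      _  = []
  distinct⇒Unique (a ∷ w) eq =
    notAny≡⇒All≢ a w (∧-conicalˡ _ _ eq) ∷ distinct⇒Unique w (∧-conicalʳ _ _ eq)

  Unique⇒distinct : ∀ w → Unique w → distinct w ≡ true
  Unique⇒distinct []      _          = refl
  Unique⇒distinct (a ∷ w) (a∉ ∷ !w) = cong₂ _∧_ (All≢⇒notAny≡ a w a∉) (Unique⇒distinct w !w)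

  avoiders : ℕ → List (List ℕ)
  avoiders n = filter (λ w → T? (not (contains213 w))) (perms n)

  record IsAvoider (n : ℕ) (w : List ℕ) : Set where
    constructor mkAvoider
    field
      length≡ : length w ≡ n
      letters : All (Letter n) w
      unique  : Unique w
      avoids  : contains213 w ≡ false

  ∈-avoiders⁻ : ∀ n {w} → w ∈ avoiders n → IsAvoider n w
  ∈-avoiders⁻ n w∈ with ∈-filter⁻ (λ w → T? (not (contains213 w))) w∈
  ... | w∈perms , avoids with ∈-filter⁻ (λ w → T? (distinct w)) w∈perms
  ... | w∈words , dist with ∈-words⁻ n n w∈words
  ... | |w|≡n , letters =
    mkAvoider |w|≡n letters (distinct⇒Unique _ (T⇒≡true dist)) (not-injective (T⇒≡true avoids))

  ∈-avoiders⁺ : ∀ n {w} → IsAvoider n w → w ∈ avoiders n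
  ∈-avoiders⁺ n (mkAvoider |w|≡n letters !w avoids) = ∈-filter⁺ (λ w → T? (not (contains213 w)))
    (∈-filter⁺ (λ w → T? (distinct w)) (∈-words⁺ n n |w|≡n letters) (≡true⇒T (Unique⇒distinct _ !w)))
    (≡true⇒T (cong not avoids))

  avoiders-unique : ∀ n → Unique (avoiders n)
  avoiders-unique n = Unique.filter⁺ _ (Unique.filter⁺ _ (words-unique n n))

module Pattern213 where

  open NatBool

  shift : ℕ → List ℕ → List ℕ
  shift c = map (c ℕ.+_)

  <ᵇ-shift : ∀ c a b → ((c ℕ.+ a) <ᵇ (c ℕ.+ b)) ≡ (a <ᵇ b)
  <ᵇ-shift zero          a b = refl
  <ᵇ-shift (suc zero)    a b = refl
  <ᵇ-shift (suc (suc c)) a b = <ᵇ-shift (suc c) a b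

  any->-shift : ∀ c a w → any ((c ℕ.+ a) <ᵇ_) (shift c w) ≡ any (a <ᵇ_) w
  any->-shift c a []      = refl
  any->-shift c a (b ∷ w) = cong₂ _∨_ (<ᵇ-shift c a b) (any->-shift c a w)

  has213From-shift : ∀ c a w → has213From (c ℕ.+ a) (shift c w) ≡ has213From a w
  has213From-shift c a []      = refl
  has213From-shift c a (b ∷ w) =
    cong₂ _∨_ (cong₂ _∧_ (<ᵇ-shift c b a) (any->-shift c a w)) (has213From-shift c a w)

  contains213-shift : ∀ c w → contains213 (shift c w) ≡ contains213 w
  contains213-shift c []      = refl
  contains213-shift c (a ∷ w) = cong₂ _∨_ (has213From-shift c a w) (contains213-shift c w)

  any-++ : ∀ (p : ℕ → Bool) xs ys → any p (xs ++ ys) ≡ (any p xs ∨ any p ys)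
  any-++ p []       ys = refl
  any-++ p (x ∷ xs) ys = ≡.trans (cong (p x ∨_) (any-++ p xs ys)) (≡.sym (∨-assoc (p x) _ _))

  any-∈ : ∀ (p : ℕ → Bool) {x xs} → x ∈ xs → p x ≡ true → any p xs ≡ true
  any-∈ p {xs = _ ∷ xs} (here refl) px = cong (_∨ any p xs) px
  any-∈ p {xs = y ∷ _} (there x∈)  px = ≡.trans (cong (p y ∨_) (any-∈ p x∈ px)) (∨-zeroʳ (p y))

  any-none : ∀ (p : ℕ → Bool) xs → All (λ x → p x ≡ false) xs → any p xs ≡ false
  any-none p []       _           = refl
  any-none p (x ∷ xs) (px ∷ pxs) = cong₂ _∨_ px (any-none p xs pxs)

  none-above : ∀ a R → All (_< a) R → any (a <ᵇ_) R ≡ false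
  none-above a R R<a = any-none _ R (All.map (λ b<a → ≮⇒<ᵇ-false (ℕₚ.<-asym b<a)) R<a)

  has213From-below : ∀ a R → All (_< a) R → has213From a R ≡ false
  has213From-below a []      _           = refl
  has213From-below a (b ∷ R) (b<a ∷ R<a) =
    cong₂ _∨_ (≡.trans (cong ((b <ᵇ a) ∧_) (none-above a R R<a)) (∧-zeroʳ _)) (has213From-below a R R<a)

  has213From-++-below : ∀ a xs R → All (_< a) R → has213From a (xs ++ R) ≡ has213From a xs
  has213From-++-below a []       R R<a = has213From-below a R R<a
  has213From-++-below a (b ∷ xs) R R<a = cong₂ _∨_
    (cong ((b <ᵇ a) ∧_) (≡.trans (any-++ _ xs R)
       (≡.trans (cong (any (a <ᵇ_) xs ∨_) (none-above a R R<a)) (∨-identityʳ _))))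
    (has213From-++-below a xs R R<a)

  ∨-trueˡ : ∀ {a} b → a ≡ true → (a ∨ b) ≡ true
  ∨-trueˡ b refl = refl

  ∨-trueʳ : ∀ a {b} → b ≡ true → (a ∨ b) ≡ true
  ∨-trueʳ a refl = ∨-zeroʳ a

  has213From-++ʳ : ∀ a xs ys → has213From a ys ≡ true → has213From a (xs ++ ys) ≡ true
  has213From-++ʳ a []       ys h = h
  has213From-++ʳ a (b ∷ xs) ys h = ∨-trueʳ ((b <ᵇ a) ∧ any (a <ᵇ_) (xs ++ ys)) (has213From-++ʳ a xs ys h)

  has213From-++ˡ : ∀ a xs ys → has213From a xs ≡ true → has213From a (xs ++ ys) ≡ true
  has213From-++ˡ a (b ∷ xs) ys h with (b <ᵇ a) ∧ any (a <ᵇ_) xs in first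
  ... | false = ∨-trueʳ ((b <ᵇ a) ∧ any (a <ᵇ_) (xs ++ ys)) (has213From-++ˡ a xs ys h)
  ... | true  = ∨-trueˡ (has213From a (xs ++ ys)) (cong₂ _∧_ (∧-conicalˡ _ _ first)
                  (≡.trans (any-++ _ xs ys) (∨-trueˡ (any (a <ᵇ_) ys) (∧-conicalʳ _ _ first))))

  contains213-++ʳ : ∀ xs ys → contains213 ys ≡ true → contains213 (xs ++ ys) ≡ true
  contains213-++ʳ []       ys c = c
  contains213-++ʳ (a ∷ xs) ys c = ∨-trueʳ (has213From a (xs ++ ys)) (contains213-++ʳ xs ys c)

  contains213-++ˡ : ∀ xs ys → contains213 xs ≡ true → contains213 (xs ++ ys) ≡ true
  contains213-++ˡ (a ∷ xs) ys c with has213From a xs in h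
  ... | true  = ∨-trueˡ (contains213 (xs ++ ys)) (has213From-++ˡ a xs ys h)
  ... | false = ∨-trueʳ (has213From a (xs ++ ys)) (contains213-++ˡ xs ys c)

  avoids-++⁻ˡ : ∀ xs ys → contains213 (xs ++ ys) ≡ false → contains213 xs ≡ false
  avoids-++⁻ˡ xs ys av = ¬-not (λ c → case ≡.trans (≡.sym (contains213-++ˡ xs ys c)) av of λ ())

  avoids-++⁻ʳ : ∀ xs ys → contains213 (xs ++ ys) ≡ false → contains213 ys ≡ false
  avoids-++⁻ʳ xs ys av = ¬-not (λ c → case ≡.trans (≡.sym (contains213-++ʳ xs ys c)) av of λ ())

  avoids-glue : ∀ A B → contains213 A ≡ false → contains213 B ≡ false →
    All (1 <_) A → All (1 <_) B → All (λ a → All (_< a) B) A → contains213 (A ++ 1 ∷ B) ≡ false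
  avoids-glue []      B _    avB _          B>1 _          =
    cong₂ _∨_ (has213From-1 B B>1) avB
    where
    has213From-1 : ∀ B → All (1 <_) B → has213From 1 B ≡ false
    has213From-1 []      _           = refl
    has213From-1 (b ∷ B) (1<b ∷ B>1) =
      cong₂ _∨_ (cong (_∧ any (1 <ᵇ_) B) (≮⇒<ᵇ-false (ℕₚ.<-asym 1<b))) (has213From-1 B B>1)
  avoids-glue (a ∷ A) B avA avB (1<a ∷ A>1) B>1 (B<a ∷ B<A) =
    cong₂ _∨_ (≡.trans (has213From-++-below a A (1 ∷ B) (1<a ∷ B<a)) (∨-conicalˡ _ _ avA))
              (avoids-glue A B (∨-conicalʳ _ _ avA) avB A>1 B>1 B<A)

  avoids⇒before-1-above-after : ∀ A B {a b} → contains213 (A ++ 1 ∷ B) ≡ false →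
                                a ∈ A → b ∈ B → 1 < a → ¬ (a < b)
  avoids⇒before-1-above-after (a ∷ A) B av (here refl) b∈ 1<a a<b =
    case ≡.trans (≡.sym (∨-trueˡ (contains213 (A ++ 1 ∷ B)) (has213From-++ʳ a A (1 ∷ B)
           (∨-trueˡ (has213From a B) (cong₂ _∧_ (<⇒<ᵇ-true 1<a) (any-∈ _ b∈ (<⇒<ᵇ-true a<b))))))) av of λ ()
  avoids⇒before-1-above-after (_ ∷ A) B av (there a∈) b∈ 1<a a<b =
    avoids⇒before-1-above-after A B (∨-conicalʳ _ _ av) a∈ b∈ 1<a a<b

module Decomposition where

  open ListSum
  open NatBool
  open Avoiders
  open Pattern213
  open UniqueLists
  open ListFacts

  glue : ℕ → List ℕ → List ℕ → List ℕ
  glue t σ τ = shift (suc t) σ ++ 1 ∷ shift 1 τ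

  gluedAt : ℕ → ℕ → List (List ℕ)
  gluedAt n m = concatMap (λ σ → map (glue (n ∸ m) σ) (avoiders (n ∸ m))) (avoiders m)

  glued : ℕ → List (List ℕ)
  glued n = concatMap (gluedAt n) (upTo (suc n))

  indexOf1 : List ℕ → ℕ
  indexOf1 []       = 0
  indexOf1 (x ∷ xs) = if x ≡ᵇ 1 then 0 else suc (indexOf1 xs)

  indexOf1-++ : ∀ A B → All (1 <_) A → indexOf1 (A ++ 1 ∷ B) ≡ length A
  indexOf1-++ []                B _                 = refl
  indexOf1-++ (suc (suc a) ∷ A) B (_ ∷ A>1)         = cong suc (indexOf1-++ A B A>1)
  indexOf1-++ (suc zero ∷ A)    B (s≤s () ∷ _)

  module _ (n m : ℕ) (m≤n : m ≤ n) {σ τ : List ℕ} (σ-av : IsAvoider m σ) (τ-av : IsAvoider (n ∸ m) τ) where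
    private
      t : ℕ
      t = n ∸ m
      m+t≡n : m ℕ.+ t ≡ n
      m+t≡n = ℕₚ.m+[n∸m]≡n m≤n
      high : All (λ x → suc (suc t) ≤ x × x ≤ suc n) (shift (suc t) σ)
      high = All.map⁺ (All.map (λ (1≤a , a≤m) →
               ℕₚ.≤-trans (ℕₚ.≤-reflexive (cong suc (≡.sym (ℕₚ.+-comm t 1)))) (ℕₚ.+-monoʳ-≤ (suc t) 1≤a)
             , ℕₚ.≤-trans (ℕₚ.+-monoʳ-≤ (suc t) a≤m) (ℕₚ.≤-reflexive (cong suc (≡.trans (ℕₚ.+-comm t m) m+t≡n))))
             (IsAvoider.letters σ-av))
      low : All (λ y → 2 ≤ y × y ≤ suc t) (shift 1 τ)
      low = All.map⁺ (All.map (λ (1≤b , b≤t) → s≤s 1≤b , s≤s b≤t) (IsAvoider.letters τ-av))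
      high>1 : All (1 <_) (shift (suc t) σ)
      high>1 = All.map (λ (t+2≤a , _) → ℕₚ.≤-trans (s≤s (s≤s z≤n)) t+2≤a) high

    glue-isAvoider : IsAvoider (suc n) (glue t σ τ)
    glue-isAvoider = mkAvoider length≡ letters unique avoids
      where
      length≡ : length (glue t σ τ) ≡ suc n
      length≡ = begin
        length (glue t σ τ)                                   ≡⟨ List.length-++ (shift (suc t) σ) ⟩
        length (shift (suc t) σ) ℕ.+ suc (length (shift 1 τ)) ≡⟨ cong₂ (λ a b → a ℕ.+ suc b)
                                                                   (≡.trans (List.length-map _ σ) (IsAvoider.length≡ σ-av))
                                                                   (≡.trans (List.length-map _ τ) (IsAvoider.length≡ τ-av)) ⟩
        m ℕ.+ suc t                                           ≡⟨ ℕₚ.+-suc m t ⟩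
        suc (m ℕ.+ t)                                         ≡⟨ cong suc m+t≡n ⟩
        suc n                                                 ∎
        where open ≡.≡-Reasoning
      letters : All (Letter (suc n)) (glue t σ τ)
      letters = All.++⁺ (All.map (λ (t+2≤a , a≤n+1) → ℕₚ.≤-trans (s≤s z≤n) t+2≤a , a≤n+1) high)
                  ((s≤s z≤n , s≤s z≤n)
                   ∷ All.map (λ (2≤b , b≤t+1) → ℕₚ.≤-trans (s≤s z≤n) 2≤b , ℕₚ.≤-trans b≤t+1 (s≤s (ℕₚ.m∸n≤m n m))) low)
      unique : Unique (glue t σ τ)
      unique = Unique.++⁺ (Unique.map⁺ (ℕₚ.+-cancelˡ-≡ (suc t) _ _) (IsAvoider.unique σ-av))
                 (All.map (λ (2≤b , _) b≡1 → ℕₚ.<-irrefl b≡1 2≤b) low ∷ Unique.map⁺ ℕₚ.suc-injective (IsAvoider.unique τ-av))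
                 λ { (a∈ , here refl)  → ℕₚ.<-irrefl refl (ℕₚ.≤-trans (s≤s (s≤s z≤n)) (proj₁ (All.lookup high a∈)))
                   ; (a∈ , there a∈′) → ℕₚ.<-irrefl refl
                                            (ℕₚ.≤-trans (proj₁ (All.lookup high a∈)) (proj₂ (All.lookup low a∈′))) }
      avoids : contains213 (glue t σ τ) ≡ false
      avoids = avoids-glue (shift (suc t) σ) (shift 1 τ)
                 (≡.trans (contains213-shift (suc t) σ) (IsAvoider.avoids σ-av))
                 (≡.trans (contains213-shift 1 τ) (IsAvoider.avoids τ-av))
                 high>1 (All.map proj₁ low)
                 (All.map (λ (t+2≤a , _) → All.map (λ (_ , b≤t+1) → ℕₚ.≤-trans (s≤s b≤t+1) t+2≤a) low) high)

    indexOf1-glue : indexOf1 (glue t σ τ) ≡ m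
    indexOf1-glue = ≡.trans (indexOf1-++ (shift (suc t) σ) (shift 1 τ) high>1)
                            (≡.trans (List.length-map _ σ) (IsAvoider.length≡ σ-av))

  ∈-glued⁺ : ∀ n m {σ τ} → m ≤ n → σ ∈ avoiders m → τ ∈ avoiders (n ∸ m) → glue (n ∸ m) σ τ ∈ glued n
  ∈-glued⁺ n m m≤n σ∈ τ∈ =
    ∈-concatMap⁺ _ (lose (∈-upTo⁺ (s≤s m≤n)) (∈-concatMap⁺ _ (lose σ∈ (∈-map⁺ _ τ∈))))

  ∈-glued⁻ : ∀ n {w} → w ∈ glued n →
             ∃[ m ] ∃[ σ ] ∃[ τ ] (m ≤ n × σ ∈ avoiders m × τ ∈ avoiders (n ∸ m) × w ≡ glue (n ∸ m) σ τ)
  ∈-glued⁻ n w∈ with find (∈-concatMap⁻ _ {upTo (suc n)} w∈)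
  ... | m , m∈ , w∈′ with find (∈-concatMap⁻ _ {avoiders m} w∈′)
  ... | σ , σ∈ , w∈″ with ∈-map⁻ _ w∈″
  ... | τ , τ∈ , w≡ = m , σ , τ , ℕₚ.≤-pred (∈-upTo⁻ m∈) , σ∈ , τ∈ , w≡

  glued⊆avoiders : ∀ n {w} → w ∈ glued n → w ∈ avoiders (suc n)
  glued⊆avoiders n w∈ with ∈-glued⁻ n w∈
  ... | m , σ , τ , m≤n , σ∈ , τ∈ , refl =
    ∈-avoiders⁺ (suc n) (glue-isAvoider n m m≤n (∈-avoiders⁻ m σ∈) (∈-avoiders⁻ (n ∸ m) τ∈))

  -- Otherwise its n + 1 distinct letters would fit into {2, …, n + 1}.
  1∈avoider : ∀ n {w} → IsAvoider (suc n) w → 1 ∈ w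
  1∈avoider n {w} (mkAvoider length≡ letters !w _) with 1 ∈? w
  ... | yes 1∈w = 1∈w
  ... | no  1∉w = ⊥-elim (ℕₚ.<-irrefl refl (ℕₚ.≤-trans (ℕₚ.≤-reflexive (≡.sym length≡))
        (Unique-between⇒length≤ (suc (suc n)) 2 w !w
          (All.zipWith (λ ((1≤a , a≤n+1) , 1≢a) → ℕₚ.≤∧≢⇒< 1≤a 1≢a , s≤s a≤n+1) (letters , All.¬Any⇒All¬ w 1∉w)))))

  module Split (n : ℕ) (A B : List ℕ) (w-av : IsAvoider (suc n) (A ++ 1 ∷ B)) where
    open IsAvoider w-av
    private
      m t : ℕ
      m = length A
      t = length B

      m+t+1≡n+1 : m ℕ.+ suc t ≡ suc n
      m+t+1≡n+1 = ≡.trans (≡.sym (List.length-++ A)) length≡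

      m≤n : m ≤ n
      m≤n = ℕₚ.≤-pred (ℕₚ.≤-trans (ℕₚ.m≤m+n (suc m) t)
              (ℕₚ.≤-reflexive (≡.trans (≡.sym (ℕₚ.+-suc m t)) m+t+1≡n+1)))

      n∸m≡t : n ∸ m ≡ t
      n∸m≡t = ≡.trans (cong (_∸ m) (ℕₚ.suc-injective (≡.trans (≡.sym m+t+1≡n+1) (ℕₚ.+-suc m t))))
                      (ℕₚ.m+n∸m≡n m t)

      ≥2 : All (λ a → 2 ≤ a × a ≤ suc n) (A ++ B)
      ≥2 = All.zipWith (λ ((1≤a , a≤n+1) , 1≢a) → ℕₚ.≤∧≢⇒< 1≤a 1≢a , a≤n+1)
             (All.++⁺ (All.++⁻ˡ A letters) (All.tail (All.++⁻ʳ A letters)) , proj₂ (Unique-remove A unique))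

      A≥2 : All (λ a → 2 ≤ a × a ≤ suc n) A
      A≥2 = All.++⁻ˡ A ≥2

      B≥2 : All (λ b → 2 ≤ b × b ≤ suc n) B
      B≥2 = All.++⁻ʳ A ≥2

      !A : Unique A
      !A = Unique-++⁻ˡ A unique

      !B : Unique B
      !B with Unique-++⁻ʳ A unique
      ... | _ ∷ !B = !B

      B<A : ∀ {a b} → a ∈ A → b ∈ B → b < a
      B<A a∈ b∈ = ℕₚ.≤∧≢⇒< (ℕₚ.≮⇒≥ (avoids⇒before-1-above-after A B avoids a∈ b∈ (proj₁ (All.lookup A≥2 a∈))))
                            (λ b≡a → Unique-++⇒disjoint A unique a∈ (there b∈) (≡.sym b≡a))

      -- The m letters of A are distinct and lie in (b, n + 1], so b ≤ n + 1 − m = t + 1.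
      B≤t+1 : All (_≤ suc t) B
      B≤t+1 = All.tabulate λ {b} b∈ → ℕₚ.+-cancelˡ-≤ m b (suc t) (ℕₚ.≤-trans
                (ℕₚ.+-monoˡ-≤ b (ℕₚ.≤-trans
                   (Unique-between⇒length≤ (suc (suc n)) (suc b) A !A
                      (All.tabulate (λ a∈ → B<A a∈ b∈ , s≤s (proj₂ (All.lookup A≥2 a∈)))))
                   (ℕₚ.≤-reflexive (cong (_∸ b) (≡.sym m+t+1≡n+1)))))
                (ℕₚ.≤-reflexive (ℕₚ.m∸n+n≡m (ℕₚ.≤-trans (proj₂ (All.lookup B≥2 b∈)) (ℕₚ.≤-reflexive (≡.sym m+t+1≡n+1))))))

      -- The t letters of B are distinct and lie in [2, a), so t ≤ a − 2.
      A≥t+2 : All (suc (suc t) ≤_) A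
      A≥t+2 = All.tabulate λ {a} a∈ → t+2≤a a (proj₁ (All.lookup A≥2 a∈))
                (Unique-between⇒length≤ a 2 B !B (All.tabulate (λ b∈ → proj₁ (All.lookup B≥2 b∈) , B<A a∈ b∈)))
        where
        t+2≤a : ∀ a → 2 ≤ a → t ≤ a ∸ 2 → suc (suc t) ≤ a
        t+2≤a (suc (suc a)) _         t≤a = s≤s (s≤s t≤a)
        t+2≤a (suc zero)    (s≤s ()) _

      unshift : ∀ c (xs : List ℕ) → All (c ≤_) xs → shift c (map (_∸ c) xs) ≡ xs
      unshift c xs c≤xs = ≡.trans (≡.sym (List.map-∘ xs)) (List.map-id-local (All.map ℕₚ.m+[n∸m]≡n c≤xs))

    σ τ : List ℕ
    σ = map (_∸ suc t) A
    τ = map (_∸ 1) B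

    shift-σ : shift (suc t) σ ≡ A
    shift-σ = unshift (suc t) A (All.map (ℕₚ.≤-trans (ℕₚ.n≤1+n _)) A≥t+2)

    shift-τ : shift 1 τ ≡ B
    shift-τ = unshift 1 B (All.map (λ (2≤b , _) → ℕₚ.≤-trans (s≤s z≤n) 2≤b) B≥2)

    σ-avoider : IsAvoider m σ
    σ-avoider = mkAvoider (List.length-map _ A)
      (All.map⁺ (All.zipWith (λ (t+2≤a , (_ , a≤n+1)) → ℕₚ.m<n⇒0<n∸m t+2≤a ,
          ℕₚ.≤-trans (ℕₚ.∸-monoˡ-≤ (suc t) a≤n+1)
                     (ℕₚ.≤-reflexive (≡.trans (cong (_∸ suc t) (≡.sym m+t+1≡n+1)) (ℕₚ.m+n∸n≡m m (suc t)))))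
        (A≥t+2 , A≥2)))
      (Unique.map⁻ (subst Unique (≡.sym shift-σ) !A))
      (≡.trans (≡.sym (contains213-shift (suc t) σ)) (≡.trans (cong contains213 shift-σ) (avoids-++⁻ˡ A (1 ∷ B) avoids)))

    τ-avoider : IsAvoider t τ
    τ-avoider = mkAvoider (List.length-map _ B)
      (All.map⁺ (All.zipWith (λ ((2≤b , _) , b≤t+1) → ℕₚ.m<n⇒0<n∸m 2≤b , ℕₚ.∸-monoˡ-≤ 1 b≤t+1) (B≥2 , B≤t+1)))
      (Unique.map⁻ (subst Unique (≡.sym shift-τ) !B))
      (≡.trans (≡.sym (contains213-shift 1 τ))
        (≡.trans (cong contains213 shift-τ) (∨-conicalʳ _ _ (avoids-++⁻ʳ A (1 ∷ B) avoids))))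

    split∈glued : A ++ 1 ∷ B ∈ glued n
    split∈glued = subst (_∈ glued n) (cong₂ (λ X Y → X ++ 1 ∷ Y) shift-σ shift-τ)
      (subst (λ s → τ ∈ avoiders s → glue s σ τ ∈ glued n) n∸m≡t (∈-glued⁺ n m m≤n (∈-avoiders⁺ m σ-avoider))
             (∈-avoiders⁺ t τ-avoider))

  avoiders⊆glued : ∀ n {w} → w ∈ avoiders (suc n) → w ∈ glued n
  avoiders⊆glued n {w} w∈ with ∈-avoiders⁻ (suc n) w∈
  ... | w-av with ∈-∃++ (1∈avoider n w-av)
  ... | A , B , refl = Split.split∈glued n A B w-av

  glue-injectiveʳ : ∀ t σ {τ τ′} → glue t σ τ ≡ glue t σ τ′ → τ ≡ τ′
  glue-injectiveʳ t σ eq =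
    List.map-injective ℕₚ.suc-injective (List.∷-injectiveʳ (List.++-cancelˡ (shift (suc t) σ) _ _ eq))

  glue-injectiveˡ : ∀ t {σ σ′ τ τ′} → length σ ≡ length σ′ → glue t σ τ ≡ glue t σ′ τ′ → σ ≡ σ′
  glue-injectiveˡ t {σ} {σ′} {τ} {τ′} |σ|≡|σ′| eq = List.map-injective (ℕₚ.+-cancelˡ-≡ (suc t) _ _) (begin
    shift (suc t) σ                                                 ≡⟨ take-length-++ (shift (suc t) σ) _ ⟨
    take (length (shift (suc t) σ)) (glue t σ τ)                    ≡⟨ cong₂ take |shift-σ|≡|shift-σ′| eq ⟩
    take (length (shift (suc t) σ′)) (glue t σ′ τ′)                  ≡⟨ take-length-++ (shift (suc t) σ′) _ ⟩
    shift (suc t) σ′                                                ∎)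
    where
    open ≡.≡-Reasoning
    |shift-σ|≡|shift-σ′| : length (shift (suc t) σ) ≡ length (shift (suc t) σ′)
    |shift-σ|≡|shift-σ′| = ≡.trans (List.length-map _ σ) (≡.trans |σ|≡|σ′| (≡.sym (List.length-map _ σ′)))

  glued-unique : ∀ n → Unique (glued n)
  glued-unique n = Unique-concatMap⁺ _ (Unique.upTo⁺ (suc n)) (λ m _ → gluedAt-unique m) sameIndexOf1
    where
    gluedAt-unique : ∀ m → Unique (gluedAt n m)
    gluedAt-unique m = Unique-concatMap⁺ _ (avoiders-unique m)
      (λ σ _ → Unique.map⁺ (glue-injectiveʳ (n ∸ m) σ) (avoiders-unique (n ∸ m)))
      λ σ∈ σ′∈ w∈ w∈′ → case ∈-map⁻ _ w∈ , ∈-map⁻ _ w∈′ of λ where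
        ((_ , _ , refl) , (_ , _ , eq)) → glue-injectiveˡ (n ∸ m)
          (≡.trans (IsAvoider.length≡ (∈-avoiders⁻ m σ∈)) (≡.sym (IsAvoider.length≡ (∈-avoiders⁻ m σ′∈)))) eq

    indexOf1-gluedAt : ∀ {m w} → m ∈ upTo (suc n) → w ∈ gluedAt n m → indexOf1 w ≡ m
    indexOf1-gluedAt {m} m∈ w∈ with find (∈-concatMap⁻ _ {avoiders m} w∈)
    ... | σ , σ∈ , w∈′ with ∈-map⁻ _ w∈′
    ... | τ , τ∈ , refl = indexOf1-glue n m (ℕₚ.≤-pred (∈-upTo⁻ m∈)) (∈-avoiders⁻ m σ∈) (∈-avoiders⁻ (n ∸ m) τ∈)

    sameIndexOf1 : ∀ {m m′ w} → m ∈ upTo (suc n) → m′ ∈ upTo (suc n) → w ∈ gluedAt n m → w ∈ gluedAt n m′ → m ≡ m′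
    sameIndexOf1 m∈ m′∈ w∈ w∈′ = ≡.trans (≡.sym (indexOf1-gluedAt m∈ w∈)) (indexOf1-gluedAt m′∈ w∈′)

  sumOver-avoiders-suc : ∀ n (F : List ℕ → ℤ) → sumOver (avoiders (suc n)) F ≡
    sumTo n (λ m → sumOver (avoiders m) (λ σ → sumOver (avoiders (n ∸ m)) (λ τ → F (glue (n ∸ m) σ τ))))
  sumOver-avoiders-suc n F = begin
    sumOver (avoiders (suc n)) F
      ≡⟨ sumOver-sameElements F (avoiders-unique (suc n)) (glued-unique n) (avoiders⊆glued n) (glued⊆avoiders n) ⟩
    sumOver (glued n) F
      ≡⟨ sumOver-concatMap (gluedAt n) (upTo (suc n)) F ⟩
    sumOver (upTo (suc n)) (λ m → sumOver (gluedAt n m) F)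
      ≡⟨ sumOver-upTo n _ ⟩
    sumTo n (λ m → sumOver (gluedAt n m) F)
      ≡⟨ SumTo.sumTo-cong n (λ m → ≡.trans (sumOver-concatMap _ (avoiders m) F)
                                            (sumOver-cong (avoiders m) (λ σ → sumOver-map _ (avoiders (n ∸ m)) F))) ⟩
    sumTo n (λ m → sumOver (avoiders m) (λ σ → sumOver (avoiders (n ∸ m)) (λ τ → F (glue (n ∸ m) σ τ))))
      ∎
    where open ≡.≡-Reasoning

module Occurrences where

  open NatBool
  open Pattern213 using (shift; <ᵇ-shift)
  open ListFacts

  bit : Bool → ℕ
  bit b = if b then 1 else 0

  bit-≡ᵇ+bit-<ᵇ : ∀ k x → bit (x ≡ᵇ k) ℕ.+ bit (k <ᵇ x) ≡ bit (k <ᵇ suc x)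
  bit-≡ᵇ+bit-<ᵇ zero    zero    = refl
  bit-≡ᵇ+bit-<ᵇ (suc k) zero    = refl
  bit-≡ᵇ+bit-<ᵇ zero    (suc x) = refl
  bit-≡ᵇ+bit-<ᵇ (suc k) (suc x) = bit-≡ᵇ+bit-<ᵇ k x

  bit-≡ᵇ+bit-≤ᵇ : ∀ k x → bit (suc x ≡ᵇ k) ℕ.+ bit (k ≤ᵇ x) ≡ bit (k ≤ᵇ suc x)
  bit-≡ᵇ+bit-≤ᵇ zero    x = refl
  bit-≡ᵇ+bit-≤ᵇ (suc k) x = bit-≡ᵇ+bit-<ᵇ k x

  bit-∧ : ∀ a b c d → bit a ℕ.+ bit b ≡ bit c → bit (a ∧ d) ℕ.+ bit (b ∧ d) ≡ bit (c ∧ d)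
  bit-∧ a b c true  eq rewrite ∧-identityʳ a | ∧-identityʳ b | ∧-identityʳ c = eq
  bit-∧ a b c false eq rewrite ∧-zeroʳ a | ∧-zeroʳ b | ∧-zeroʳ c = refl

  all-true : ∀ (p : ℕ → Bool) xs → All (λ x → p x ≡ true) xs → all p xs ≡ true
  all-true p []       _          = refl
  all-true p (x ∷ xs) (px ∷ pxs) = cong₂ _∧_ px (all-true p xs pxs)

  all-above-1 : ∀ m r → 1 ∈ r → 1 ≤ m → all (m <ᵇ_) r ≡ false
  all-above-1 m (x ∷ r) (here refl) 1≤m =
    cong (_∧ all (m <ᵇ_) r) (≮⇒<ᵇ-false (λ m<1 → ℕₚ.<-irrefl refl (ℕₚ.≤-trans m<1 1≤m)))
  all-above-1 m (x ∷ r) (there 1∈) 1≤m = ≡.trans (cong ((m <ᵇ x) ∧_) (all-above-1 m r 1∈ 1≤m)) (∧-zeroʳ _)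

  1-off-center : ∀ k A B → All (1 <_) A → All (1 <_) B → length A ≢ k →
    drop k (A ++ 1 ∷ B) ≡ [] ⊎
    ∃[ m ] ∃[ r ] (drop k (A ++ 1 ∷ B) ≡ m ∷ r × 1 < m × (1 ∈ r ⊎ 1 ∈ take k (A ++ 1 ∷ B)))
  1-off-center zero    []      B _          _   |A|≢k = ⊥-elim (|A|≢k refl)
  1-off-center zero    (a ∷ A) B (1<a ∷ _) _   _     = inj₂ (a , A ++ 1 ∷ B , refl , 1<a , inj₁ (∈-++⁺ʳ A (here refl)))
  1-off-center (suc k) []      B _          B>1 _ with drop k B in eq
  ... | []    = inj₁ refl
  ... | m ∷ r = inj₂ (m , r , refl , All.lookup B>1 (∈-drop k B (subst (m ∈_) (≡.sym eq) (here refl))) , inj₂ (here refl))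
  1-off-center (suc k) (a ∷ A) B (_ ∷ A>1) B>1 |A|≢k with 1-off-center k A B A>1 B>1 (λ eq → |A|≢k (cong suc eq))
  ... | inj₁ eq                          = inj₁ eq
  ... | inj₂ (m , r , eq , 1<m , inj₁ 1∈) = inj₂ (m , r , eq , 1<m , inj₁ 1∈)
  ... | inj₂ (m , r , eq , 1<m , inj₂ 1∈) = inj₂ (m , r , eq , 1<m , inj₂ (there 1∈))

  module _ (k l : ℕ) where

    width : ℕ
    width = k ℕ.+ l ℕ.+ 1

    isOcc-drop≡∷ : ∀ f {m r} → drop k f ≡ m ∷ r →
      isOcc k l f ≡ ((length f ≡ᵇ width) ∧ all (m <ᵇ_) (take k f) ∧ all (m <ᵇ_) r)
    isOcc-drop≡∷ f eq with drop k f | eq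
    ... | _ | refl = refl

    isOcc-drop≡[] : ∀ f → drop k f ≡ [] → isOcc k l f ≡ false
    isOcc-drop≡[] f eq with drop k f | eq
    ... | _ | refl = refl

    isOcc-length≢ : ∀ f → length f ≢ width → isOcc k l f ≡ false
    isOcc-length≢ f |f|≢ with drop k f
    ... | []    = refl
    ... | m ∷ r with length f ≡ᵇ width in eq
    ...   | false = refl
    ...   | true  = ⊥-elim (|f|≢ (≡ᵇ-true⇒≡ eq))

    isOcc-1-off-center : ∀ A B → All (1 <_) A → All (1 <_) B → length A ≢ k → isOcc k l (A ++ 1 ∷ B) ≡ false
    isOcc-1-off-center A B A>1 B>1 |A|≢k with 1-off-center k A B A>1 B>1 |A|≢k
    ... | inj₁ eq = isOcc-drop≡[] _ eq
    ... | inj₂ (m , r , eq , 1<m , inj₁ 1∈r) = ≡.trans (isOcc-drop≡∷ _ eq)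
          (≡.trans (cong (λ z → (length (A ++ 1 ∷ B) ≡ᵇ width) ∧ all (m <ᵇ_) (take k (A ++ 1 ∷ B)) ∧ z)
                         (all-above-1 m r 1∈r (ℕₚ.<⇒≤ 1<m)))
                   (≡.trans (cong ((length (A ++ 1 ∷ B) ≡ᵇ width) ∧_) (∧-zeroʳ _)) (∧-zeroʳ _)))
    ... | inj₂ (m , r , eq , 1<m , inj₂ 1∈prefix) = ≡.trans (isOcc-drop≡∷ _ eq)
          (≡.trans (cong (λ z → (length (A ++ 1 ∷ B) ≡ᵇ width) ∧ z ∧ all (m <ᵇ_) r)
                         (all-above-1 m _ 1∈prefix (ℕₚ.<⇒≤ 1<m)))
                   (∧-zeroʳ _))

    k<width : k < width
    k<width = ℕₚ.≤-trans (s≤s (ℕₚ.m≤m+n k l)) (ℕₚ.≤-reflexive (ℕₚ.+-comm 1 (k ℕ.+ l)))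

    width∸[1+k]≡l : width ∸ suc k ≡ l
    width∸[1+k]≡l = ≡.trans (cong (_∸ suc k) (ℕₚ.+-comm (k ℕ.+ l) 1)) (ℕₚ.m+n∸m≡n k l)

    isFullWindow : ∀ (A B : List ℕ) → length A ≡ k → (length (A ++ 1 ∷ take l B) ≡ᵇ width) ≡ (l ≤ᵇ length B)
    isFullWindow A B |A|≡k = ⇔→≡ {z = true} (mk⇔
      (λ eq → ≤⇒≤ᵇ-true (length-take-≡ l B (ℕₚ.+-cancelˡ-≡ k _ _ (ℕₚ.+-cancelʳ-≡ 1 _ _
                 (≡.trans (≡.sym (k+x+1 _)) (≡.trans (≡.sym |window|) (≡ᵇ-true⇒≡ eq)))))))
      (λ eq → ≡⇒≡ᵇ-true (≡.trans |window| (≡.trans (k+x+1 _) (cong (λ z → k ℕ.+ z ℕ.+ 1)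
                 (length-take-≤ l B (≤ᵇ-true⇒≤ eq)))))))
      where
      |window| : length (A ++ 1 ∷ take l B) ≡ k ℕ.+ suc (length (take l B))
      |window| = ≡.trans (List.length-++ A) (cong (ℕ._+ suc (length (take l B))) |A|≡k)
      k+x+1 : ∀ x → k ℕ.+ suc x ≡ k ℕ.+ x ℕ.+ 1
      k+x+1 x = ≡.trans (ℕₚ.+-suc k x) (ℕₚ.+-comm 1 (k ℕ.+ x))

    -- A window starting in A is either inside A, or contains the letter 1, which must then be its centre.
    firstWindow-glue : ∀ A B → All (1 <_) A → All (1 <_) B →
      bit (isOcc k l (take width (A ++ 1 ∷ B))) ≡ bit (isOcc k l (take width A)) ℕ.+ bit ((length A ≡ᵇ k) ∧ (l ≤ᵇ length B))
    firstWindow-glue A B A>1 B>1 with width ℕ.≤? length A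
    ... | yes width≤|A| rewrite take-++-short width A (1 ∷ B) width≤|A|
          | ¬-not {length A ≡ᵇ k} (λ eq → ℕₚ.<-irrefl (≡.sym (≡ᵇ-true⇒≡ eq)) (ℕₚ.≤-trans k<width width≤|A|))
          = ≡.sym (ℕₚ.+-identityʳ _)
    ... | no width≰|A| rewrite List.take-all width A (ℕₚ.<⇒≤ (ℕₚ.≰⇒> width≰|A|))
          | isOcc-length≢ A (λ eq → width≰|A| (ℕₚ.≤-reflexive (≡.sym eq)))
          | take-++-∷ width A B (ℕₚ.≰⇒> width≰|A|) with length A ℕ.≟ k
    ...   | no |A|≢k rewrite isOcc-1-off-center A (take (width ∸ suc (length A)) B) A>1 (All.take⁺ _ B>1) |A|≢k
                           | ¬-not {length A ≡ᵇ k} (λ eq → |A|≢k (≡ᵇ-true⇒≡ eq)) = refl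
    ...   | yes |A|≡k rewrite |A|≡k | ≡⇒≡ᵇ-true {k} refl | width∸[1+k]≡l
                     | isOcc-drop≡∷ (A ++ 1 ∷ take l B)
                         (subst (λ z → drop z (A ++ 1 ∷ take l B) ≡ 1 ∷ take l B) |A|≡k (drop-length-++ A _))
                     | subst (λ z → take z (A ++ 1 ∷ take l B) ≡ A) |A|≡k (take-length-++ A _)
                     | all-true (1 <ᵇ_) A (All.map <⇒<ᵇ-true A>1)
                     | all-true (1 <ᵇ_) (take l B) (All.map <⇒<ᵇ-true (All.take⁺ _ B>1))
                     | ∧-identityʳ (length (A ++ 1 ∷ take l B) ≡ᵇ width)
                     | isFullWindow A B |A|≡k = refl

    occ-glue : ∀ A B → All (1 <_) A → All (1 <_) B →
               occ k l (A ++ 1 ∷ B) ≡ occ k l A ℕ.+ occ k l B ℕ.+ bit ((k ≤ᵇ length A) ∧ (l ≤ᵇ length B))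
    occ-glue [] B A>1 B>1 = ≡.trans (cong (ℕ._+ occ k l B) (≡.trans (firstWindow-glue [] B A>1 B>1)
        (cong₂ ℕ._+_ (cong bit (≡.trans (cong (isOcc k l) (List.take-[] width)) (isOcc-length≢ [] width≢0)))
                     (cong (λ z → bit (z ∧ (l ≤ᵇ length B))) (0≡ᵇk k)))))
      (ℕₚ.+-comm _ (occ k l B))
      where
      width≢0 : 0 ≢ width
      width≢0 eq = ℕₚ.0≢1+n (≡.trans eq (ℕₚ.+-comm (k ℕ.+ l) 1))
      0≡ᵇk : ∀ k → (0 ≡ᵇ k) ≡ (k ≤ᵇ 0)
      0≡ᵇk zero    = refl
      0≡ᵇk (suc k) = refl
    occ-glue (a ∷ A) B (1<a ∷ A>1) B>1 = begin
        bit (isOcc k l (take width (a ∷ A ++ 1 ∷ B))) ℕ.+ occ k l (A ++ 1 ∷ B)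
      ≡⟨ cong₂ ℕ._+_ (firstWindow-glue (a ∷ A) B (1<a ∷ A>1) B>1) (occ-glue A B A>1 B>1) ⟩
        w ℕ.+ e₁ ℕ.+ (occ k l A ℕ.+ occ k l B ℕ.+ e₂)
      ≡⟨ rearrange w e₁ (occ k l A) (occ k l B) e₂ ⟩
        w ℕ.+ occ k l A ℕ.+ occ k l B ℕ.+ (e₁ ℕ.+ e₂)
      ≡⟨ cong (w ℕ.+ occ k l A ℕ.+ occ k l B ℕ.+_)
              (bit-∧ (suc (length A) ≡ᵇ k) (k ≤ᵇ length A) _ (l ≤ᵇ length B) (bit-≡ᵇ+bit-≤ᵇ k (length A))) ⟩
        w ℕ.+ occ k l A ℕ.+ occ k l B ℕ.+ bit ((k ≤ᵇ suc (length A)) ∧ (l ≤ᵇ length B))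
      ∎
      where
      open ≡.≡-Reasoning
      open ℕ-Solver using (solve; _:+_; _:=_)
      w e₁ e₂ : ℕ
      w  = bit (isOcc k l (take width (a ∷ A)))
      e₁ = bit ((suc (length A) ≡ᵇ k) ∧ (l ≤ᵇ length B))
      e₂ = bit ((k ≤ᵇ length A) ∧ (l ≤ᵇ length B))
      rearrange : ∀ w e₁ oA oB e₂ → w ℕ.+ e₁ ℕ.+ (oA ℕ.+ oB ℕ.+ e₂) ≡ w ℕ.+ oA ℕ.+ oB ℕ.+ (e₁ ℕ.+ e₂)
      rearrange = solve 5 (λ w e₁ oA oB e₂ → w :+ e₁ :+ (oA :+ oB :+ e₂) := w :+ oA :+ oB :+ (e₁ :+ e₂)) refl

    all->-shift : ∀ c m xs → all ((c ℕ.+ m) <ᵇ_) (shift c xs) ≡ all (m <ᵇ_) xs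
    all->-shift c m []       = refl
    all->-shift c m (x ∷ xs) = cong₂ _∧_ (<ᵇ-shift c m x) (all->-shift c m xs)

    isOcc-shift : ∀ c u → isOcc k l (shift c u) ≡ isOcc k l u
    isOcc-shift c u with drop k u in eq
    ... | []    = isOcc-drop≡[] (shift c u) (≡.trans (List.drop-map k u) (cong (shift c) eq))
    ... | m ∷ r = ≡.trans (isOcc-drop≡∷ (shift c u) (≡.trans (List.drop-map k u) (cong (shift c) eq)))
        (cong₂ _∧_ (cong (_≡ᵇ width) (List.length-map _ u))
          (cong₂ _∧_ (≡.trans (cong (all ((c ℕ.+ m) <ᵇ_)) (List.take-map k u)) (all->-shift c m (take k u)))
                     (all->-shift c m r)))

    occ-shift : ∀ c w → occ k l (shift c w) ≡ occ k l w
    occ-shift c []      = refl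
    occ-shift c (a ∷ w) =
      cong₂ ℕ._+_ (cong bit (≡.trans (cong (isOcc k l) (List.take-map width (a ∷ w))) (isOcc-shift c _)))
                  (occ-shift c w)

    occ-short : ∀ w → length w < width → occ k l w ≡ 0
    occ-short []      _        = refl
    occ-short (a ∷ w) |w|<width = cong₂ ℕ._+_
      (cong bit (isOcc-length≢ (take width (a ∷ w))
        (λ eq → ℕₚ.<-irrefl (≡.trans (≡.sym (cong length (List.take-all width (a ∷ w) (ℕₚ.<⇒≤ |w|<width)))) eq) |w|<width)))
      (occ-short w (ℕₚ.<-trans (ℕₚ.n<1+n _) |w|<width))

module Convolution where

  open SumTo
  open ListSum
  open NatBool

  ≤ᵇ-step : ∀ x j → x ≢ suc j → (x ≤ᵇ j) ≡ (x ≤ᵇ suc j)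
  ≤ᵇ-step x j x≢1+j = ⇔→≡ {z = true} (mk⇔ (λ eq → ≤⇒≤ᵇ-true (ℕₚ.m≤n⇒m≤1+n (≤ᵇ-true⇒≤ {x} {j} eq)))
                                         (λ eq → ≤⇒≤ᵇ-true (ℕₚ.≤-pred (ℕₚ.≤∧≢⇒< (≤ᵇ-true⇒≤ {x} {suc j} eq) x≢1+j))))

  sumTo-single : ∀ j x (g : ℕ → ℤ) → (∀ b → b ≢ x → g b ≡ + 0) → sumTo j g ≡ (if x ≤ᵇ j then g x else + 0)
  sumTo-single zero    zero    g _      = refl
  sumTo-single zero    (suc x) g g≡0    = g≡0 0 (λ ())
  sumTo-single (suc j) x       g g≡0 with x ℕ.≟ suc j
  ... | yes refl rewrite sumTo-single j (suc j) g g≡0 | ≮⇒<ᵇ-false (ℕₚ.<-irrefl (refl {x = suc j}))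
                        | <⇒<ᵇ-true (ℕₚ.n<1+n j) = ℤₚ.+-identityˡ _
  ... | no x≢1+j rewrite sumTo-single j x g g≡0 | g≡0 (suc j) (λ eq → x≢1+j (≡.sym eq)) | ≤ᵇ-step x j x≢1+j =
    ℤₚ.+-identityʳ _

  indicator-+≡ᵇ : ∀ x y j → indicator (x ℕ.+ y ≡ᵇ j) ≡ sumTo j (λ b → indicator (x ≡ᵇ b) ℤ.* indicator (y ≡ᵇ j ∸ b))
  indicator-+≡ᵇ x y j = ≡.sym (≡.trans (sumTo-single j x _ off-x) (at-x x j))
    where
    off-x : ∀ b → b ≢ x → indicator (x ≡ᵇ b) ℤ.* indicator (y ≡ᵇ j ∸ b) ≡ + 0
    off-x b b≢x rewrite ¬-not {x ≡ᵇ b} (λ eq → b≢x (≡.sym (≡ᵇ-true⇒≡ eq))) = refl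
    at-x : ∀ x j → (if x ≤ᵇ j then indicator (x ≡ᵇ x) ℤ.* indicator (y ≡ᵇ j ∸ x) else + 0) ≡ indicator (x ℕ.+ y ≡ᵇ j)
    at-x zero    j       = ℤₚ.*-identityˡ _
    at-x (suc x) zero    = refl
    at-x (suc x) (suc j) =
      ≡.trans (cong (λ c → if c then indicator (x ≡ᵇ x) ℤ.* indicator (y ≡ᵇ j ∸ x) else + 0) (≤ᵇ-suc x j)) (at-x x j)
      where
      ≤ᵇ-suc : ∀ x j → (suc x ≤ᵇ suc j) ≡ (x ≤ᵇ j)
      ≤ᵇ-suc zero    j = refl
      ≤ᵇ-suc (suc x) j = refl

  sumOver-convolution : ∀ {A B : Set} (L₁ : List A) (L₂ : List B) (o₁ : A → ℕ) (o₂ : B → ℕ) j →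
    sumOver L₁ (λ σ → sumOver L₂ (λ τ → indicator (o₁ σ ℕ.+ o₂ τ ≡ᵇ j))) ≡
    sumTo j (λ b → sumOver L₁ (λ σ → indicator (o₁ σ ≡ᵇ b)) ℤ.* sumOver L₂ (λ τ → indicator (o₂ τ ≡ᵇ j ∸ b)))
  sumOver-convolution L₁ L₂ o₁ o₂ j = begin
      sumOver L₁ (λ σ → sumOver L₂ (λ τ → indicator (o₁ σ ℕ.+ o₂ τ ≡ᵇ j)))
    ≡⟨ sumOver-cong L₁ (λ σ → ≡.trans (sumOver-cong L₂ (λ τ → indicator-+≡ᵇ (o₁ σ) (o₂ τ) j)) (sumOver-sumTo L₂ j _)) ⟩
      sumOver L₁ (λ σ → sumTo j (λ b → sumOver L₂ (λ τ → indicator (o₁ σ ≡ᵇ b) ℤ.* indicator (o₂ τ ≡ᵇ j ∸ b))))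
    ≡⟨ sumOver-sumTo L₁ j _ ⟩
      sumTo j (λ b → sumOver L₁ (λ σ → sumOver L₂ (λ τ → indicator (o₁ σ ≡ᵇ b) ℤ.* indicator (o₂ τ ≡ᵇ j ∸ b))))
    ≡⟨ sumTo-cong j (λ b → ≡.trans
         (sumOver-cong L₁ (λ σ → ≡.sym (*-distribˡ-sumOver L₂ (indicator (o₁ σ ≡ᵇ b)) (λ τ → indicator (o₂ τ ≡ᵇ j ∸ b)))))
         (≡.sym (*-distribʳ-sumOver L₁ (sumOver L₂ (λ τ → indicator (o₂ τ ≡ᵇ j ∸ b))) (λ σ → indicator (o₁ σ ≡ᵇ b))))) ⟩
      sumTo j (λ b → sumOver L₁ (λ σ → indicator (o₁ σ ≡ᵇ b)) ℤ.* sumOver L₂ (λ τ → indicator (o₂ τ ≡ᵇ j ∸ b)))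
    ∎
    where open ≡.≡-Reasoning

module Recurrence (k l : ℕ) where

  open SumTo
  open ListSum
  open Avoiders
  open Pattern213 using (shift)
  open Decomposition
  open Occurrences
  open Convolution
  open Bivariate using (timesY)

  P : Series
  P = Pser k l

  P≡sumOver : ∀ n j → P n j ≡ sumOver (avoiders n) (λ w → indicator (occ k l w ≡ᵇ j))
  P≡sumOver n j = length-filter-∧ (perms n) (λ w → not (contains213 w)) (λ w → occ k l w ≡ᵇ j)

  conv : ℕ → ℕ → ℕ → ℤ
  conv m t j = sumTo j (λ b → P m b ℤ.* P t (j ∸ b))

  bothLong : ℕ → ℕ → Bool
  bothLong m t = (k ≤ᵇ m) ∧ (l ≤ᵇ t)

  occ-glue-avoiders : ∀ m t {σ τ} → σ ∈ avoiders m → τ ∈ avoiders t →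
                      occ k l (glue t σ τ) ≡ occ k l σ ℕ.+ occ k l τ ℕ.+ bit (bothLong m t)
  occ-glue-avoiders m t {σ} {τ} σ∈ τ∈ = ≡.trans (occ-glue k l (shift (suc t) σ) (shift 1 τ) σ>1 τ>1)
    (cong₂ ℕ._+_ (cong₂ ℕ._+_ (occ-shift k l (suc t) σ) (occ-shift k l 1 τ))
      (cong bit (cong₂ (λ a b → (k ≤ᵇ a) ∧ (l ≤ᵇ b))
        (≡.trans (List.length-map _ σ) (IsAvoider.length≡ (∈-avoiders⁻ m σ∈)))
        (≡.trans (List.length-map _ τ) (IsAvoider.length≡ (∈-avoiders⁻ t τ∈))))))
    where
    σ>1 : All (1 ℕ.<_) (shift (suc t) σ)
    σ>1 = All.map⁺ (All.map (λ (1≤a , _) → s≤s (ℕₚ.≤-trans 1≤a (ℕₚ.m≤n+m _ t))) (IsAvoider.letters (∈-avoiders⁻ m σ∈)))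
    τ>1 : All (1 ℕ.<_) (shift 1 τ)
    τ>1 = All.map⁺ (All.map (λ (1≤b , _) → s≤s 1≤b) (IsAvoider.letters (∈-avoiders⁻ t τ∈)))

  gluedCount : ∀ m t j →
    sumOver (avoiders m) (λ σ → sumOver (avoiders t) (λ τ → indicator (occ k l (glue t σ τ) ≡ᵇ j))) ≡
    (if bothLong m t then timesY (conv m t) j else conv m t j)
  gluedCount m t j = ≡.trans
    (sumOver-cong∈ (avoiders m) (λ σ σ∈ → sumOver-cong∈ (avoiders t) (λ τ τ∈ →
      cong (λ o → indicator (o ≡ᵇ j)) (occ-glue-avoiders m t σ∈ τ∈))))
    (byExtra (bothLong m t) j)
    where
    unglued : ∀ j → sumOver (avoiders m) (λ σ → sumOver (avoiders t) (λ τ → indicator (occ k l σ ℕ.+ occ k l τ ≡ᵇ j)))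
                    ≡ conv m t j
    unglued j = ≡.trans (sumOver-convolution (avoiders m) (avoiders t) (occ k l) (occ k l) j)
                        (sumTo-cong j (λ b → ≡.sym (cong₂ ℤ._*_ (P≡sumOver m b) (P≡sumOver t (j ∸ b)))))
    byExtra : ∀ e j →
      sumOver (avoiders m) (λ σ → sumOver (avoiders t) (λ τ → indicator (occ k l σ ℕ.+ occ k l τ ℕ.+ bit e ≡ᵇ j)))
      ≡ (if e then timesY (conv m t) j else conv m t j)
    byExtra false j = ≡.trans (sumOver-cong (avoiders m) (λ σ → sumOver-cong (avoiders t) (λ τ →
                        cong (λ o → indicator (o ≡ᵇ j)) (ℕₚ.+-identityʳ (occ k l σ ℕ.+ occ k l τ))))) (unglued j)
    byExtra true zero = sumOver-zero (avoiders m) _ (λ σ → sumOver-zero (avoiders t) _ (λ τ →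
                        cong (λ o → indicator (o ≡ᵇ 0)) (ℕₚ.+-comm (occ k l σ ℕ.+ occ k l τ) 1)))
    byExtra true (suc j) = ≡.trans (sumOver-cong (avoiders m) (λ σ → sumOver-cong (avoiders t) (λ τ →
                        cong (λ o → indicator (o ≡ᵇ suc j)) (ℕₚ.+-comm (occ k l σ ℕ.+ occ k l τ) 1)))) (unglued j)

  P-suc : ∀ n j → P (suc n) j ≡
          sumTo n (λ m → if bothLong m (n ∸ m) then timesY (conv m (n ∸ m)) j else conv m (n ∸ m) j)
  P-suc n j = ≡.trans (P≡sumOver (suc n) j) (≡.trans (sumOver-avoiders-suc n (λ w → indicator (occ k l w ≡ᵇ j)))
                (sumTo-cong n (λ m → gluedCount m (n ∸ m) j)))

  P-zero : ∀ j → P 0 j ≡ const (+ 1) 0 j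
  P-zero zero    = refl
  P-zero (suc j) = refl

  P-short : ∀ m j → m < width k l → P m j ≡ (if j ≡ᵇ 0 then + length (avoiders m) else + 0)
  P-short m j m<width = ≡.trans (P≡sumOver m j) (≡.trans (sumOver-cong∈ (avoiders m) (λ w w∈ →
      cong (λ o → indicator (o ≡ᵇ j)) (occ-short k l w (ℕₚ.≤-trans (ℕₚ.≤-reflexive
        (cong suc (IsAvoider.length≡ (∈-avoiders⁻ m w∈)))) m<width))))
    (noOccurrences j))
    where
    noOccurrences : ∀ j → sumOver (avoiders m) (λ _ → indicator (0 ≡ᵇ j)) ≡ (if j ≡ᵇ 0 then + length (avoiders m) else + 0)
    noOccurrences zero    = ≡.sym (length≡sumOver-1 (avoiders m))
    noOccurrences (suc j) = sumOver-zero (avoiders m) _ (λ _ → refl)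

module AvoiderGeneratingFunction where

  open SumTo
  open ListSum
  open Avoiders
  open Decomposition
  open Bivariate
  open Derivative
  open Solver using (solve; _:=_; con; _:+_; _:*_; _:-_; :-_)
  open import Relation.Binary.Reasoning.Setoid 𝕊.setoid

  #avoiders : ℕ → ℕ
  #avoiders n = length (avoiders n)

  #avoiders-suc : ∀ n → + #avoiders (suc n) ≡ sumTo n (λ m → + #avoiders m ℤ.* + #avoiders (n ∸ m))
  #avoiders-suc n = ≡.trans (length≡sumOver-1 (avoiders (suc n))) (≡.trans (sumOver-avoiders-suc n (λ _ → + 1))
    (sumTo-cong n (λ m → ≡.trans (sumOver-cong (avoiders m) (λ σ → ≡.sym (ℤₚ.*-identityˡ _)))
      (≡.trans (≡.sym (*-distribʳ-sumOver (avoiders m) _ _))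
               (≡.sym (cong₂ ℤ._*_ (length≡sumOver-1 (avoiders m)) (length≡sumOver-1 (avoiders (n ∸ m)))))))))

  A : Series
  A n zero    = + #avoiders n
  A n (suc j) = + 0

  A≈1+XA² : A ≈ const (+ 1) ⊕ X ⊗ (A ⊗ A)
  A≈1+XA² zero    zero    = ≡.sym (ℤₚ.+-identityʳ _)
  A≈1+XA² zero    (suc j) = ≡.sym (≡.trans (ℤₚ.+-identityˡ _) (X⊗-zero (A ⊗ A) (suc j)))
  A≈1+XA² (suc n) zero    = ≡.trans (#avoiders-suc n) (≡.sym (≡.trans (ℤₚ.+-identityˡ _) (X⊗-suc (A ⊗ A) n 0)))
  A≈1+XA² (suc n) (suc j) = ≡.sym (≡.trans (ℤₚ.+-identityˡ _) (≡.trans (X⊗-suc (A ⊗ A) n (suc j))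
    (sumTo-zero n _ (λ a → sumTo-zero (suc j) _ (λ { zero → ℤₚ.*-zeroʳ (A a 0) ; (suc b) → refl })))))

  u E B : Series
  u = X ⊗ A
  E = ∂ u
  B = const (+ 1) ⊖ (u ⊕ u)

  u≈X+u² : u ≈ X ⊕ u ⊗ u
  u≈X+u² = begin
    X ⊗ A
      ≈⟨ 𝕊.*-congˡ {X} A≈1+XA² ⟩
    X ⊗ (const (+ 1) ⊕ X ⊗ (A ⊗ A))
      ≈⟨ solve 2 (λ x a → x :* (con (+ 1) :+ x :* (a :* a)) := x :+ (x :* a) :* (x :* a)) 𝕊.refl X A ⟩
    X ⊕ u ⊗ u
      ∎

  u⊖u²≈X : u ⊖ u ⊗ u ≈ X
  u⊖u²≈X = begin
    u ⊖ u ⊗ u              ≈⟨ 𝕊.+-congʳ {𝕊.- (u ⊗ u)} u≈X+u² ⟩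
    X ⊕ u ⊗ u ⊖ u ⊗ u      ≈⟨ solve 2 (λ x v → x :+ v :* v :- v :* v := x) 𝕊.refl X u ⟩
    X                      ∎

  E≈1+2uE : E ≈ const (+ 1) ⊕ (E ⊗ u ⊕ u ⊗ E)
  E≈1+2uE = begin
    ∂ u                            ≈⟨ ∂-cong u≈X+u² ⟩
    ∂ (X ⊕ u ⊗ u)                  ≈⟨ ∂-⊕ X (u ⊗ u) ⟩
    ∂ X ⊕ ∂ (u ⊗ u)                ≈⟨ 𝕊.+-cong ∂-X (∂-⊗ u u) ⟩
    const (+ 1) ⊕ (E ⊗ u ⊕ u ⊗ E)  ∎

  E⊗B≈1 : E ⊗ B ≈ const (+ 1)
  E⊗B≈1 = begin
    E ⊗ B
      ≈⟨ solve 2 (λ e v → e :* (con (+ 1) :- (v :+ v)) := e :- (e :* v :+ v :* e)) 𝕊.refl E u ⟩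
    E ⊖ (E ⊗ u ⊕ u ⊗ E)
      ≈⟨ 𝕊.+-congʳ E≈1+2uE ⟩
    const (+ 1) ⊕ (E ⊗ u ⊕ u ⊗ E) ⊖ (E ⊗ u ⊕ u ⊗ E)
      ≈⟨ solve 2 (λ o w → o :+ w :- w := o) 𝕊.refl (const (+ 1)) (E ⊗ u ⊕ u ⊗ E) ⟩
    const (+ 1)
      ∎

  ∂B≈-2E : ∂ B ≈ 𝕊.- (E ⊕ E)
  ∂B≈-2E = begin
    ∂ (const (+ 1) ⊕ 𝕊.- (u ⊕ u))      ≈⟨ ∂-⊕ (const (+ 1)) (𝕊.- (u ⊕ u)) ⟩
    ∂ (const (+ 1)) ⊕ ∂ (𝕊.- (u ⊕ u))  ≈⟨ 𝕊.+-cong (∂-const (+ 1)) (∂-neg (u ⊕ u)) ⟩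
    𝕊.0# ⊕ 𝕊.- ∂ (u ⊕ u)               ≈⟨ 𝕊.+-identityˡ _ ⟩
    𝕊.- ∂ (u ⊕ u)                      ≈⟨ 𝕊.-‿cong (∂-⊕ u u) ⟩
    𝕊.- (E ⊕ E)                        ∎

  ∂E⊗B≈2E² : ∂ E ⊗ B ≈ E ⊗ (E ⊕ E)
  ∂E⊗B≈2E² = begin
    ∂ E ⊗ B
      ≈⟨ solve 4 (λ d e b b′ → d :* b := d :* b :+ e :* b′ :- e :* b′) 𝕊.refl (∂ E) E B (∂ B) ⟩
    ∂ E ⊗ B ⊕ E ⊗ ∂ B ⊖ E ⊗ ∂ B
      ≈⟨ 𝕊.+-congʳ (𝕊.sym (∂-⊗ E B)) ⟩
    ∂ (E ⊗ B) ⊖ E ⊗ ∂ B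
      ≈⟨ 𝕊.+-cong (𝕊.trans (∂-cong E⊗B≈1) (∂-const (+ 1))) (𝕊.-‿cong (𝕊.*-congˡ {E} ∂B≈-2E)) ⟩
    𝕊.0# ⊖ E ⊗ 𝕊.- (E ⊕ E)
      ≈⟨ 𝕊.+-identityˡ _ ⟩
    𝕊.- (E ⊗ 𝕊.- (E ⊕ E))
      ≈⟨ solve 1 (λ e → :- (e :* (:- (e :+ e))) := e :* (e :+ e)) 𝕊.refl E ⟩
    E ⊗ (E ⊕ E)
      ∎

  B²≈1-4X : B ⊗ B ≈ const (+ 1) ⊖ const (+ 4) ⊗ X
  B²≈1-4X = begin
    B ⊗ B
      ≈⟨ solve 1 (λ v → (con (+ 1) :- (v :+ v)) :* (con (+ 1) :- (v :+ v)) := con (+ 1) :- con (+ 4) :* (v :- v :* v))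
               𝕊.refl u ⟩
    const (+ 1) ⊖ const (+ 4) ⊗ (u ⊖ u ⊗ u)
      ≈⟨ 𝕊.+-congˡ {const (+ 1)} (𝕊.-‿cong (𝕊.*-congˡ {const (+ 4)} u⊖u²≈X)) ⟩
    const (+ 1) ⊖ const (+ 4) ⊗ X
      ∎

  -- (1 − 4x) E′ = B² E′ = 2 E · (E B) = 2 E.
  ∂E-equation : ∂ E ≈ E ⊕ E ⊕ const (+ 4) ⊗ (X ⊗ ∂ E)
  ∂E-equation = begin
    ∂ E
      ≈⟨ solve 2 (λ d x → d := (con (+ 1) :- con (+ 4) :* x) :* d :+ con (+ 4) :* (x :* d)) 𝕊.refl (∂ E) X ⟩
    (const (+ 1) ⊖ const (+ 4) ⊗ X) ⊗ ∂ E ⊕ R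
      ≈⟨ 𝕊.+-congʳ {R} (𝕊.*-congʳ {∂ E} (𝕊.sym B²≈1-4X)) ⟩
    B ⊗ B ⊗ ∂ E ⊕ R
      ≈⟨ 𝕊.+-congʳ {R} (solve 2 (λ b d → b :* b :* d := b :* (d :* b)) 𝕊.refl B (∂ E)) ⟩
    B ⊗ (∂ E ⊗ B) ⊕ R
      ≈⟨ 𝕊.+-congʳ {R} (𝕊.*-congˡ {B} ∂E⊗B≈2E²) ⟩
    B ⊗ (E ⊗ (E ⊕ E)) ⊕ R
      ≈⟨ 𝕊.+-congʳ {R} (solve 2 (λ b e → b :* (e :* (e :+ e)) := (e :+ e) :* (e :* b)) 𝕊.refl B E) ⟩
    (E ⊕ E) ⊗ (E ⊗ B) ⊕ R
      ≈⟨ 𝕊.+-congʳ {R} (𝕊.*-congˡ {E ⊕ E} E⊗B≈1) ⟩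
    (E ⊕ E) ⊗ const (+ 1) ⊕ R
      ≈⟨ 𝕊.+-congʳ {R} (𝕊.*-identityʳ (E ⊕ E)) ⟩
    E ⊕ E ⊕ R
      ∎
    where
    R : Series
    R = const (+ 4) ⊗ (X ⊗ ∂ E)

module CatalanNumbers where

  open Bivariate using (X⊗-zero; X⊗-suc; const⊗)
  open Derivative using (∂)
  open AvoiderGeneratingFunction
  open ≡.≡-Reasoning

  E-coeff : ∀ n → E n 0 ≡ + suc n ℤ.* + #avoiders n
  E-coeff n = cong (+ suc n ℤ.*_) (X⊗-suc A n 0)

  X⊗∂E-coeff : ∀ n → (X ⊗ ∂ E) n 0 ≡ + n ℤ.* E n 0
  X⊗∂E-coeff zero    = X⊗-zero (∂ E) 0
  X⊗∂E-coeff (suc n) = X⊗-suc (∂ E) n 0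

  #avoiders-step : ∀ n → + suc (suc n) ℤ.* + #avoiders (suc n) ≡ (+ 2 ℤ.+ + 4 ℤ.* + n) ℤ.* + #avoiders n
  #avoiders-step n = ℤₚ.*-cancelˡ-≡ (+ suc n) _ _ (begin
      + suc n ℤ.* (+ suc (suc n) ℤ.* a′)
    ≡⟨ cong (+ suc n ℤ.*_) (E-coeff (suc n)) ⟨
      ∂ E n 0
    ≡⟨ ∂E-equation n 0 ⟩
      E n 0 ℤ.+ E n 0 ℤ.+ (const (+ 4) ⊗ (X ⊗ ∂ E)) n 0
    ≡⟨ cong₂ ℤ._+_ (cong₂ ℤ._+_ (E-coeff n) (E-coeff n))
                   (≡.trans (const⊗ (+ 4) (X ⊗ ∂ E) n 0)
                            (cong (+ 4 ℤ.*_) (≡.trans (X⊗∂E-coeff n) (cong (+ n ℤ.*_) (E-coeff n))))) ⟩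
      + suc n ℤ.* a ℤ.+ + suc n ℤ.* a ℤ.+ + 4 ℤ.* (+ n ℤ.* (+ suc n ℤ.* a))
    ≡⟨ solve 2 (λ n a → (con (+ 1) :+ n) :* a :+ (con (+ 1) :+ n) :* a :+ con (+ 4) :* (n :* ((con (+ 1) :+ n) :* a))
                        := (con (+ 1) :+ n) :* ((con (+ 2) :+ con (+ 4) :* n) :* a)) refl (+ n) a ⟩
      + suc n ℤ.* ((+ 2 ℤ.+ + 4 ℤ.* + n) ℤ.* a)
    ∎)
    where
    open ℤ-Solver using (solve; _:=_; con; _:+_; _:*_)
    a a′ : ℤ
    a  = + #avoiders n
    a′ = + #avoiders (suc n)

  #avoiders-stepℕ : ∀ n → suc (suc n) ℕ.* #avoiders (suc n) ≡ (2 ℕ.+ 4 ℕ.* n) ℕ.* #avoiders n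
  #avoiders-stepℕ n = ℤₚ.+-injective (begin
    + (suc (suc n) ℕ.* #avoiders (suc n))          ≡⟨ ℤₚ.pos-* (suc (suc n)) (#avoiders (suc n)) ⟩
    + suc (suc n) ℤ.* + #avoiders (suc n)          ≡⟨ #avoiders-step n ⟩
    (+ 2 ℤ.+ + 4 ℤ.* + n) ℤ.* + #avoiders n        ≡⟨ cong (ℤ._* + #avoiders n) (≡.trans (cong (ℤ._+_ (+ 2)) (≡.sym (ℤₚ.pos-* 4 n)))
                                                                                        (≡.sym (ℤₚ.pos-+ 2 (4 ℕ.* n)))) ⟩
    + (2 ℕ.+ 4 ℕ.* n) ℤ.* + #avoiders n            ≡⟨ ℤₚ.pos-* (2 ℕ.+ 4 ℕ.* n) (#avoiders n) ⟨
    + ((2 ℕ.+ 4 ℕ.* n) ℕ.* #avoiders n)            ∎)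

  [k+1]*[n+1]C[k+1]≡[n+1]*nCk : ∀ n k → suc k ℕ.* (suc n C suc k) ≡ suc n ℕ.* (n C k)
  [k+1]*[n+1]C[k+1]≡[n+1]*nCk zero    zero    = refl
  [k+1]*[n+1]C[k+1]≡[n+1]*nCk zero    (suc k) = ℕₚ.*-zeroʳ (suc (suc k))
  [k+1]*[n+1]C[k+1]≡[n+1]*nCk (suc n) zero    =
    ≡.trans (ℕₚ.+-identityʳ _) (≡.trans (nC1≡n (suc (suc n))) (≡.sym (ℕₚ.*-identityʳ (suc (suc n)))))
  [k+1]*[n+1]C[k+1]≡[n+1]*nCk (suc n) (suc k) = begin
      suc (suc k) ℕ.* (suc (suc n) C suc (suc k))
    ≡⟨ cong (suc (suc k) ℕ.*_) (nCk+nC[k+1]≡[n+1]C[k+1] (suc n) (suc k)) ⟨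
      suc (suc k) ℕ.* (a ℕ.+ b)
    ≡⟨ solve 3 (λ x a b → (con 2 :+ x) :* (a :+ b) := a :+ (con 1 :+ x) :* a :+ (con 2 :+ x) :* b) refl k a b ⟩
      a ℕ.+ suc k ℕ.* a ℕ.+ suc (suc k) ℕ.* b
    ≡⟨ cong₂ (λ p q → a ℕ.+ p ℕ.+ q) ([k+1]*[n+1]C[k+1]≡[n+1]*nCk n k) ([k+1]*[n+1]C[k+1]≡[n+1]*nCk n (suc k)) ⟩
      a ℕ.+ suc n ℕ.* (n C k) ℕ.+ suc n ℕ.* (n C suc k)
    ≡⟨ ≡.trans (ℕₚ.+-assoc a _ _) (cong (a ℕ.+_) (≡.sym (ℕₚ.*-distribˡ-+ (suc n) (n C k) (n C suc k)))) ⟩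
      a ℕ.+ suc n ℕ.* (n C k ℕ.+ n C suc k)
    ≡⟨ cong (λ z → a ℕ.+ suc n ℕ.* z) (nCk+nC[k+1]≡[n+1]C[k+1] n k) ⟩
      a ℕ.+ suc n ℕ.* a
    ∎
    where
    open ℕ-Solver using (solve; _:=_; con; _:+_; _:*_)
    a b : ℕ
    a = suc n C suc k
    b = suc n C suc (suc k)

  [n+1]*[2n+2]C[n+1]≡[4n+2]*[2n]Cn : ∀ n → suc n ℕ.* ((2 ℕ.* suc n) C suc n) ≡ (2 ℕ.+ 4 ℕ.* n) ℕ.* ((2 ℕ.* n) C n)
  [n+1]*[2n+2]C[n+1]≡[4n+2]*[2n]Cn n = ℕₚ.*-cancelˡ-≡ _ _ (suc n) (begin
      suc n ℕ.* (suc n ℕ.* ((2 ℕ.* suc n) C suc n))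
    ≡⟨ cong (λ z → suc n ℕ.* (suc n ℕ.* (z C suc n))) (ℕₚ.*-suc 2 n) ⟩
      suc n ℕ.* (suc n ℕ.* (suc (suc (2 ℕ.* n)) C suc n))
    ≡⟨ cong (suc n ℕ.*_) ([k+1]*[n+1]C[k+1]≡[n+1]*nCk (suc (2 ℕ.* n)) n) ⟩
      suc n ℕ.* (suc (suc (2 ℕ.* n)) ℕ.* (suc (2 ℕ.* n) C n))
    ≡⟨ cong (λ z → suc n ℕ.* (suc (suc (2 ℕ.* n)) ℕ.* z)) symmetric ⟩
      suc n ℕ.* (suc (suc (2 ℕ.* n)) ℕ.* (suc (2 ℕ.* n) C suc n))
    ≡⟨ solve 2 (λ m y → (con 1 :+ m) :* ((con 2 :+ con 2 :* m) :* y) := (con 2 :+ con 2 :* m) :* ((con 1 :+ m) :* y))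
               refl n (suc (2 ℕ.* n) C suc n) ⟩
      suc (suc (2 ℕ.* n)) ℕ.* (suc n ℕ.* (suc (2 ℕ.* n) C suc n))
    ≡⟨ cong (suc (suc (2 ℕ.* n)) ℕ.*_) ([k+1]*[n+1]C[k+1]≡[n+1]*nCk (2 ℕ.* n) n) ⟩
      suc (suc (2 ℕ.* n)) ℕ.* (suc (2 ℕ.* n) ℕ.* ((2 ℕ.* n) C n))
    ≡⟨ solve 2 (λ m z → (con 2 :+ con 2 :* m) :* ((con 1 :+ con 2 :* m) :* z) := (con 1 :+ m) :* ((con 2 :+ con 4 :* m) :* z))
               refl n ((2 ℕ.* n) C n) ⟩
      suc n ℕ.* ((2 ℕ.+ 4 ℕ.* n) ℕ.* ((2 ℕ.* n) C n))
    ∎)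
    where
    open ℕ-Solver using (solve; _:=_; con; _:+_; _:*_)
    symmetric : suc (2 ℕ.* n) C n ≡ suc (2 ℕ.* n) C suc n
    symmetric = ≡.trans (nCk≡nC[n∸k] (ℕₚ.≤-trans (ℕₚ.m≤m+n n (n ℕ.+ 0)) (ℕₚ.n≤1+n _))) (cong (suc (2 ℕ.* n) C_) (begin
      suc (n ℕ.+ (n ℕ.+ 0)) ∸ n   ≡⟨ ℕₚ.+-∸-assoc 1 (ℕₚ.m≤m+n n (n ℕ.+ 0)) ⟩
      suc (n ℕ.+ (n ℕ.+ 0) ∸ n)   ≡⟨ cong suc (ℕₚ.m+n∸m≡n n (n ℕ.+ 0)) ⟩
      suc (n ℕ.+ 0)               ≡⟨ cong suc (ℕₚ.+-identityʳ n) ⟩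
      suc n                       ∎))

  [n+1]*#avoiders≡[2n]Cn : ∀ n → suc n ℕ.* #avoiders n ≡ (2 ℕ.* n) C n
  [n+1]*#avoiders≡[2n]Cn zero    = refl
  [n+1]*#avoiders≡[2n]Cn (suc n) = ℕₚ.*-cancelˡ-≡ _ _ (suc n) (begin
      suc n ℕ.* (suc (suc n) ℕ.* #avoiders (suc n))
    ≡⟨ cong (suc n ℕ.*_) (#avoiders-stepℕ n) ⟩
      suc n ℕ.* ((2 ℕ.+ 4 ℕ.* n) ℕ.* #avoiders n)
    ≡⟨ x∙yz≈y∙xz (suc n) (2 ℕ.+ 4 ℕ.* n) (#avoiders n) ⟩
      (2 ℕ.+ 4 ℕ.* n) ℕ.* (suc n ℕ.* #avoiders n)
    ≡⟨ cong ((2 ℕ.+ 4 ℕ.* n) ℕ.*_) ([n+1]*#avoiders≡[2n]Cn n) ⟩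
      (2 ℕ.+ 4 ℕ.* n) ℕ.* ((2 ℕ.* n) C n)
    ≡⟨ [n+1]*[2n+2]C[n+1]≡[4n+2]*[2n]Cn n ⟨
      suc n ℕ.* ((2 ℕ.* suc n) C suc n)
    ∎)
    where open CommutativeSemigroupProperties ℕₚ.*-commutativeSemigroup using (x∙yz≈y∙xz)

  catalan≡#avoiders : ∀ n → catalan n ≡ #avoiders n
  catalan≡#avoiders n = begin
    ((2 ℕ.* n) C n) / suc n          ≡⟨ cong (_/ suc n) ([n+1]*#avoiders≡[2n]Cn n) ⟨
    (suc n ℕ.* #avoiders n) / suc n  ≡⟨ cong (_/ suc n) (ℕₚ.*-comm (suc n) (#avoiders n)) ⟩
    (#avoiders n ℕ.* suc n) / suc n  ≡⟨ m*n/n≡m (#avoiders n) (suc n) ⟩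
    #avoiders n                      ∎

module QuadraticFormula where

  open Bivariate
  open import Relation.Binary.Reasoning.Setoid 𝕊.setoid

  module _ (P Pk Pl : Series) where

    rhs A S D : Series
    rhs = const (+ 1) ⊕ X ⊗ P ⊗ P ⊕ X ⊗ (Y ⊖ const (+ 1)) ⊗ (P ⊖ Pk) ⊗ (P ⊖ Pl)
    A   = X ⊗ (const (+ 1) ⊖ Y) ⊗ (Pk ⊕ Pl)
    S   = const (+ 1) ⊖ A ⊖ const (+ 2) ⊗ X ⊗ Y ⊗ P
    D   = (A ⊖ const (+ 1)) ⊗ (A ⊖ const (+ 1))
            ⊖ const (+ 4) ⊗ X ⊗ Y ⊗ (X ⊗ (Y ⊖ const (+ 1)) ⊗ Pk ⊗ Pl ⊕ const (+ 1))

    S²≈D+4xy[rhs−P] : S ⊗ S ≈ D ⊕ const (+ 4) ⊗ X ⊗ Y ⊗ (rhs ⊖ P)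
    S²≈D+4xy[rhs−P] = solve 5 (λ p pk pl x y →
      let a = x :* (con (+ 1) :- y) :* (pk :+ pl)
          s = con (+ 1) :- a :- con (+ 2) :* x :* y :* p
          d = (a :- con (+ 1)) :* (a :- con (+ 1))
                :- con (+ 4) :* x :* y :* (x :* (y :- con (+ 1)) :* pk :* pl :+ con (+ 1))
      in s :* s := d :+ con (+ 4) :* x :* y :*
                   (con (+ 1) :+ x :* p :* p :+ x :* (y :- con (+ 1)) :* (p :- pk) :* (p :- pl) :- p))
      𝕊.refl P Pk Pl X Y
      where open Solver using (solve; _:=_; con; _:+_; _:*_; _:-_)

    S²≈D : P ≈ rhs → S ⊗ S ≈ D
    S²≈D P≈rhs = begin
      S ⊗ S                             ≈⟨ S²≈D+4xy[rhs−P] ⟩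
      D ⊕ 4xy ⊗ (rhs ⊖ P)               ≈⟨ 𝕊.+-congˡ {D} (𝕊.*-congˡ {4xy} (𝕊.+-congˡ {rhs} (𝕊.-‿cong P≈rhs))) ⟩
      D ⊕ 4xy ⊗ (rhs ⊖ rhs)             ≈⟨ 𝕊.+-congˡ {D} (𝕊.*-congˡ {4xy} (𝕊.-‿inverseʳ rhs)) ⟩
      D ⊕ 4xy ⊗ 𝕊.0#                    ≈⟨ 𝕊.+-congˡ {D} (𝕊.zeroʳ 4xy) ⟩
      D ⊕ 𝕊.0#                          ≈⟨ 𝕊.+-identityʳ D ⟩
      D                                 ∎
      where
      4xy : Series
      4xy = const (+ 4) ⊗ X ⊗ Y

    S₀₀≡1 : S 0 0 ≡ + 1
    S₀₀≡1 = refl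

    2xyP≡1-A-S : ∀ n j → (const (+ 2) ⊗ X ⊗ Y ⊗ P) n j ≡ (const (+ 1) ⊖ A ⊖ S) n j
    2xyP≡1-A-S n j = ≡.sym (a-[a-t]≡t ((const (+ 1) ⊖ A) n j) ((const (+ 2) ⊗ X ⊗ Y ⊗ P) n j))
      where
      a-[a-t]≡t : ∀ a t → a ℤ.- (a ℤ.- t) ≡ t
      a-[a-t]≡t = solve 2 (λ a t → a :- (a :- t) := t) refl
        where open ℤ-Solver using (solve; _:=_; _:-_)

module OccurrenceGeneratingFunction (k l : ℕ) where

  open SumTo
  open NatBool
  open Bivariate
  open Occurrences using (width)
  open Recurrence k l
  open CatalanNumbers using (catalan≡#avoiders)
  open QuadraticFormula using (rhs)

  tail : ℕ → Series
  tail s m b = if s ≤ᵇ m then P m b else + 0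

  tail≈P⊖Ptrunc : ∀ s → s ≤ width k l → tail s ≈ P ⊖ Ptrunc s
  tail≈P⊖Ptrunc s s≤width m b with s ≤ᵇ m in s≤ᵇm
  ... | true  = ≡.sym (≡.trans (cong (λ z → P m b ℤ.- z) (truncated b)) (ℤₚ.+-identityʳ _))
    where
    truncated : ∀ b → Ptrunc s m b ≡ + 0
    truncated zero    = cong (λ c → if c then + catalan m else + 0) (≮⇒<ᵇ-false {m} {s} (ℕₚ.≤⇒≯ (≤ᵇ-true⇒≤ {s} {m} s≤ᵇm)))
    truncated (suc b) = refl
  ... | false = ≡.sym (≡.trans (cong₂ ℤ._-_ (P-short m b (ℕₚ.<-≤-trans m<s s≤width)) (truncated b))
                               (ℤₚ.+-inverseʳ (if b ≡ᵇ 0 then + #avoiders m else + 0)))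
    where
    open AvoiderGeneratingFunction using (#avoiders)
    m<s : m < s
    m<s = ≤ᵇ-false⇒> {s} {m} s≤ᵇm
    truncated : ∀ b → Ptrunc s m b ≡ (if b ≡ᵇ 0 then + #avoiders m else + 0)
    truncated zero    = ≡.trans (cong (λ c → if c then + catalan m else + 0) (<⇒<ᵇ-true m<s)) (cong +_ (catalan≡#avoiders m))
    truncated (suc b) = refl

  Q : Series
  Q = tail k ⊗ tail l

  longPart : ℕ → ℕ → ℕ → ℤ
  longPart m t j = if bothLong m t then conv m t j else + 0

  Q-coeff : ∀ n j → Q n j ≡ sumTo n (λ m → longPart m (n ∸ m) j)
  Q-coeff n j = sumTo-cong n (λ m → ≡.trans (sumTo-cong j (term m)) (sumTo-if j (bothLong m (n ∸ m)) _))
    where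
    term : ∀ m b → tail k m b ℤ.* tail l (n ∸ m) (j ∸ b) ≡
                   (if bothLong m (n ∸ m) then P m b ℤ.* P (n ∸ m) (j ∸ b) else + 0)
    term m b with k ≤ᵇ m | l ≤ᵇ (n ∸ m)
    ... | true  | true  = refl
    ... | true  | false = ℤₚ.*-zeroʳ (P m b)
    ... | false | _     = refl

  timesY-or-not : ∀ m t j → (if bothLong m t then timesY (conv m t) j else conv m t j) ≡
                  conv m t j ℤ.+ (timesY (longPart m t) j ℤ.- longPart m t j)
  timesY-or-not m t j with bothLong m t
  ... | true  = solve 2 (λ a c → a := c :+ (a :- c)) refl (timesY (conv m t) j) (conv m t j)
    where open ℤ-Solver using (solve; _:=_; _:+_; _:-_)
  ... | false = ≡.sym (≡.trans (cong (ℤ._+_ (conv m t j)) (zero-shift j)) (ℤₚ.+-identityʳ _))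
    where
    zero-shift : ∀ j → timesY (λ _ → + 0) j ℤ.- + 0 ≡ + 0
    zero-shift zero    = refl
    zero-shift (suc j) = refl

  P-recurrence : P ≈ const (+ 1) ⊕ X ⊗ (P ⊗ P ⊕ (Y ⊗ Q ⊖ Q))
  P-recurrence zero    j = ≡.trans (P-zero j) (≡.sym (≡.trans
    (cong (ℤ._+_ (const (+ 1) 0 j)) (X⊗-zero (P ⊗ P ⊕ (Y ⊗ Q ⊖ Q)) j)) (ℤₚ.+-identityʳ _)))
  P-recurrence (suc n) j = begin
      P (suc n) j
    ≡⟨ P-suc n j ⟩
      sumTo n (λ m → if bothLong m (n ∸ m) then timesY (conv m (n ∸ m)) j else conv m (n ∸ m) j)
    ≡⟨ sumTo-cong n (λ m → timesY-or-not m (n ∸ m) j) ⟩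
      sumTo n (λ m → conv m (n ∸ m) j ℤ.+ (timesY (longPart m (n ∸ m)) j ℤ.- longPart m (n ∸ m) j))
    ≡⟨ ≡.trans (sumTo-distrib-+ n _ _) (cong (ℤ._+_ (sumTo n (λ m → conv m (n ∸ m) j))) (sumTo-distrib-+ n _ _)) ⟩
      sumTo n (λ m → conv m (n ∸ m) j) ℤ.+
      (sumTo n (λ m → timesY (longPart m (n ∸ m)) j) ℤ.+ sumTo n (λ m → ℤ.- longPart m (n ∸ m) j))
    ≡⟨ cong (ℤ._+_ (sumTo n (λ m → conv m (n ∸ m) j))) (cong₂ ℤ._+_ Y-part (≡.sym (sumTo-neg n _))) ⟨
      (P ⊗ P) n j ℤ.+ ((Y ⊗ Q) n j ℤ.- sumTo n (λ m → longPart m (n ∸ m) j))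
    ≡⟨ cong (λ z → (P ⊗ P) n j ℤ.+ ((Y ⊗ Q) n j ℤ.- z)) (Q-coeff n j) ⟨
      (P ⊗ P ⊕ (Y ⊗ Q ⊖ Q)) n j
    ≡⟨ X⊗-suc (P ⊗ P ⊕ (Y ⊗ Q ⊖ Q)) n j ⟨
      (X ⊗ (P ⊗ P ⊕ (Y ⊗ Q ⊖ Q))) (suc n) j
    ≡⟨ ℤₚ.+-identityˡ _ ⟨
      (const (+ 1) ⊕ X ⊗ (P ⊗ P ⊕ (Y ⊗ Q ⊖ Q))) (suc n) j
    ∎
    where
    open ≡.≡-Reasoning
    Y-part : (Y ⊗ Q) n j ≡ sumTo n (λ m → timesY (longPart m (n ∸ m)) j)
    Y-part = ≡.trans (Y⊗ Q n j)
               (≡.trans (timesY-cong (Q-coeff n) j) (timesY-sumTo n (λ j′ m → longPart m (n ∸ m) j′) j))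

  functionalEquation : P ≈ rhs P (Ptrunc k) (Ptrunc l)
  functionalEquation = begin
      P
    ≈⟨ P-recurrence ⟩
      const (+ 1) ⊕ X ⊗ (P ⊗ P ⊕ (Y ⊗ Q ⊖ Q))
    ≈⟨ 𝕊.+-congˡ {const (+ 1)} (𝕊.*-congˡ {X} (𝕊.+-congˡ {P ⊗ P}
         (𝕊.+-cong (𝕊.*-congˡ {Y} Q≈[P−Pk][P−Pl]) (𝕊.-‿cong Q≈[P−Pk][P−Pl])))) ⟩
      const (+ 1) ⊕ X ⊗ (P ⊗ P ⊕ (Y ⊗ ((P ⊖ Ptrunc k) ⊗ (P ⊖ Ptrunc l)) ⊖ (P ⊖ Ptrunc k) ⊗ (P ⊖ Ptrunc l)))
    ≈⟨ solve 5 (λ p x y pk pl → con (+ 1) :+ x :* (p :* p :+ (y :* ((p :- pk) :* (p :- pl)) :- (p :- pk) :* (p :- pl)))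
                 := con (+ 1) :+ x :* p :* p :+ x :* (y :- con (+ 1)) :* (p :- pk) :* (p :- pl))
               𝕊.refl P X Y (Ptrunc k) (Ptrunc l) ⟩
      const (+ 1) ⊕ X ⊗ P ⊗ P ⊕ X ⊗ (Y ⊖ const (+ 1)) ⊗ (P ⊖ Ptrunc k) ⊗ (P ⊖ Ptrunc l)
    ∎
    where
    open import Relation.Binary.Reasoning.Setoid 𝕊.setoid
    open Solver using (solve; _:=_; con; _:+_; _:*_; _:-_)
    Q≈[P−Pk][P−Pl] : Q ≈ (P ⊖ Ptrunc k) ⊗ (P ⊖ Ptrunc l)
    Q≈[P−Pk][P−Pl] = 𝕊.*-cong (tail≈P⊖Ptrunc k (ℕₚ.≤-trans (ℕₚ.m≤m+n k l) (ℕₚ.m≤m+n (k ℕ.+ l) 1)))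
                              (tail≈P⊖Ptrunc l (ℕₚ.≤-trans (ℕₚ.m≤n+m l k) (ℕₚ.m≤m+n (k ℕ.+ l) 1)))

mainTheorem10 : (k l : ℕ) →
    let P  = Pser k l
        Pk = Ptrunc k
        Pl = Ptrunc l
        A  = X ⊗ (const (+ 1) ⊖ Y) ⊗ (Pk ⊕ Pl)
        D  = (A ⊖ const (+ 1)) ⊗ (A ⊖ const (+ 1))
               ⊖ const (+ 4) ⊗ X ⊗ Y ⊗ (X ⊗ (Y ⊖ const (+ 1)) ⊗ Pk ⊗ Pl ⊕ const (+ 1))
    in ∃ λ S → ((∀ n j → (S ⊗ S) n j ≡ D n j) × S 0 0 ≡ + 1)
             × (∀ n j → (const (+ 2) ⊗ X ⊗ Y ⊗ P) n j ≡ (const (+ 1) ⊖ A ⊖ S) n j)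
mainTheorem10 k l = S P Pk Pl , (S²≈D P Pk Pl functionalEquation , S₀₀≡1 P Pk Pl) , 2xyP≡1-A-S P Pk Pl
  where
  open QuadraticFormula
  open OccurrenceGeneratingFunction k l using (functionalEquation)
  P Pk Pl : Series
  P  = Pser k l
  Pk = Ptrunc k
  Pl = Ptrunc l
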